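{- If $G$ is a word-representable co-bipartite graph that is not a permutation graph, then the representation number of $G$ is $3$.
   Context: A graph $G=(V,E)$ is word-representable if there is a word $w$ over the alphabet $V$ such that for distinct $x,y\in V$, the letters $x$ and $y$ alternate in $w$ (the subword of $w$ consisting only of $x$'s and $y$'s is $xyxy\cdots$ or $yxyx\cdots$) if and only if $xy\in E$; such $w$ represents $G$ and contains each vertex at least once. A word is $k$-uniform if every letter occurs exactly $k$ times; $G$ is $k$-representable if some $k$-uniform word represents it. The representation number of a word-representable graph is the least $k$ such that it is $k$-representable. A graph is co-bipartite if its complement is bipartite. A permutation graph is a graph whose vertices can be identified with $\{1,\dots,n\}$ so that, for some permutation $\pi$ of $\{1,\dots,n\}$, $i<j$ are adjacent iff $\pi(i)>\pi(j)$. -}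

module Defs where

open import Data.Nat using (ℕ; _<_; _≤_)
open import Data.Fin as Fin using (Fin)
open import Data.Fin.Properties using (_≟_)
open import Data.Fin.Permutation using (Permutation′; _⟨$⟩ʳ_)
open import Data.Bool using (Bool; true; false; _∨_)
open import Data.List using (List; []; _∷_; filterᵇ; length)
open import Data.List.Membership.Propositional using (_∈_)
open import Data.Product using (Σ; ∃; _×_)
open import Relation.Nullary using (¬_; does)
open import Relation.Binary.PropositionalEquality using (_≡_; _≢_)
open import Function.Bundles using (_⇔_)

record Graph (n : ℕ) : Set where
  field
    adj     : Fin n → Fin n → Bool
    symm    : ∀ x y → adj x y ≡ adj y x
    irrefl  : ∀ x → adj x x ≡ false

open Graph public

Adjacent : ∀ {n} → Graph n → Fin n → Fin n → Set
Adjacent G x y = adj G x y ≡ true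

Word : ℕ → Set
Word n = List (Fin n)

restrict : ∀ {n} → Fin n → Fin n → Word n → Word n
restrict x y = filterᵇ (λ z → does (z ≟ x) ∨ does (z ≟ y))

-- a word over {x,y} is of the form xyxy... or yxyx... iff no two
-- consecutive letters are equal
data Alternating {n : ℕ} : Word n → Set where
  alt-[]  : Alternating []
  alt-one : ∀ a → Alternating (a ∷ [])
  alt-∷   : ∀ a b {w} → a ≢ b → Alternating (b ∷ w) → Alternating (a ∷ b ∷ w)

Alternate : ∀ {n} → Fin n → Fin n → Word n → Set
Alternate x y w = Alternating (restrict x y w)

Represents : ∀ {n} → Word n → Graph n → Set
Represents {n} w G =
  (∀ (x : Fin n) → x ∈ w) ×
  (∀ (x y : Fin n) → x ≢ y → (Alternate x y w ⇔ Adjacent G x y))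

WordRepresentable : ∀ {n} → Graph n → Set
WordRepresentable {n} G = Σ (Word n) λ w → Represents w G

occ : ∀ {n} → Fin n → Word n → ℕ
occ x w = length (filterᵇ (λ z → does (z ≟ x)) w)

Uniform : ∀ {n} → ℕ → Word n → Set
Uniform {n} k w = ∀ (x : Fin n) → occ x w ≡ k

KRepresentable : ∀ {n} → ℕ → Graph n → Set
KRepresentable {n} k G = Σ (Word n) λ w → Uniform k w × Represents w G

RepresentationNumber≡ : ∀ {n} → Graph n → ℕ → Set
RepresentationNumber≡ G k =
  KRepresentable k G × (∀ k′ → 1 ≤ k′ → k′ < k → ¬ KRepresentable k′ G)

CoBipartite : ∀ {n} → Graph n → Set
CoBipartite {n} G = Σ (Fin n → Bool) λ c →
  ∀ (x y : Fin n) → x ≢ y → adj G x y ≡ false → c x ≢ c y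

PermutationGraph : ∀ {n} → Graph n → Set
PermutationGraph {n} G = Σ (Permutation′ n) λ σ → Σ (Permutation′ n) λ π →
  ∀ (u v : Fin n) → σ ⟨$⟩ʳ u Fin.< σ ⟨$⟩ʳ v →
    (Adjacent G u v ⇔ π ⟨$⟩ʳ (σ ⟨$⟩ʳ v) Fin.< π ⟨$⟩ʳ (σ ⟨$⟩ʳ u))

-- Any two letters occurring once alternate, so 1-uniform words represent complete graphs, which are
-- permutation graphs. Vertices in the same colour class of a co-bipartite graph are adjacent, hence
-- alternate; this lets a 2-uniform representation be rotated so that both of its halves contain every
-- vertex once, and the graph is then the permutation graph comparing the two orders.
-- For 3-representability, make a representation uniform and rotate it so that one vertex a* of the
-- first class never falls behind a vertex of the second class. Let excess x y be the largest lead of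
-- x over y in a prefix: x and y are adjacent iff excess x y + excess y x ≤ 1, and for a in the first
-- and b in the second class, excess a b and excess b a are the integer parts of (S a + β b) / q and
-- (U a + β̄ b) / q, where q is the size of the second class, β b and β̄ b count its vertices before
-- and after b, and S a, U a sum the excesses of a over and under that class. Placing the three
-- copies of every vertex at heights computed from these numbers yields a 3-uniform word in which a
-- and b interleave exactly when that inequality holds.

module Submission where

open import Data.Nat using (ℕ)
open import Relation.Nullary using (¬_)
open import Defs
open import Data.Nat hiding (_≟_)
import Data.Nat as ℕ
open import Data.Nat.Properties hiding (_≟_)
open import Relation.Binary.Definitions using (tri<; tri≈; tri>)
open import Data.Nat.Solver using (module +-*-Solver)
open import Data.Fin as Fin using (Fin; toℕ; cast; opposite)
open import Data.Fin.Properties using (_≟_; any?; toℕ-injective; toℕ<n; toℕ-cast; cast-involutive; opposite-prop)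
open import Data.Fin.Permutation as Perm using (Permutation′; permutation; _∘ₚ_; flip; reverse)
open import Data.Bool using (Bool; true; false; if_then_else_; T?)
import Data.Bool.Properties as Bool
open import Algebra.Properties.Semiring.Sum +-*-semiring using (sum; ∑-distrib-+; sum-cong-≗; sum-replicate-zero; *-distribˡ-sum)
open import Data.List using (List; []; _∷_; _++_; take; drop; length; filter; lookup; deduplicate; tabulate; allFin)
open import Data.List.Properties using (take-[]; take-all; take-take; take++drop≡id; length-take; length-drop; length-filter; filter-all; ++-assoc; ++-identityʳ)
open import Data.List.Relation.Unary.All using (All; []; _∷_)
open import Data.List.Relation.Unary.Any using (here; there; index)
open import Data.List.Relation.Unary.Any.Properties using (lookup-index)
open import Data.List.Membership.Propositional.Properties using (∈-lookup; ∈-deduplicate⁺)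
open import Data.List.Membership.Propositional using (_∈_)
open import Data.Product using (Σ; ∃; ∃₂; _×_; _,_; proj₁; proj₂)
open import Data.Sum using (_⊎_; inj₁; inj₂; [_,_]′; swap)
open import Data.Empty using (⊥; ⊥-elim)
open import Relation.Nullary using (¬_; Dec; does; yes; no; ¬?; _×-dec_; _⊎-dec_)
open import Relation.Unary using (Pred; Decidable)
open import Level using (0ℓ)
open import Relation.Binary.PropositionalEquality
open import Function.Base using (_∘_)
open import Function.Bundles using (_⇔_; mk⇔; Equivalence)
open import Data.Sum.Function.Propositional using (_⊎-⇔_)
open import Data.Product.Function.NonDependent.Propositional using (_×-⇔_)
open import Function.Properties.Equivalence using () renaming (trans to ⇔-trans; sym to ⇔-sym)
open Equivalence using (to; from)

private
  variable
    n : ℕ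

occ-here : (x : Fin n) (w : Word n) → occ x (x ∷ w) ≡ suc (occ x w)
occ-here x w with x ≟ x
... | yes _ = refl
... | no x≢x = ⊥-elim (x≢x refl)

occ-there : {x z : Fin n} (w : Word n) → z ≢ x → occ x (z ∷ w) ≡ occ x w
occ-there {x = x} {z} w z≢x with z ≟ x
... | yes z≡x = ⊥-elim (z≢x z≡x)
... | no _ = refl

occ-++ : (x : Fin n) (u v : Word n) → occ x (u ++ v) ≡ occ x u + occ x v
occ-++ x [] v = refl
occ-++ x (z ∷ u) v with z ≟ x
... | yes _ = cong suc (occ-++ x u v)
... | no _ = occ-++ x u v

∈⇒occ>0 : {x : Fin n} {w : Word n} → x ∈ w → 0 < occ x w
∈⇒occ>0 {x = x} {z ∷ w} (here refl) = subst (0 <_) (sym (occ-here x w)) z<s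
∈⇒occ>0 {x = x} {z ∷ w} (there x∈w) with z ≟ x
... | yes _ = z<s
... | no _ = ∈⇒occ>0 x∈w

occ>0⇒∈ : {x : Fin n} (w : Word n) → 0 < occ x w → x ∈ w
occ>0⇒∈ {x = x} (z ∷ w) occ>0 with z ≟ x
... | yes refl = here refl
... | no _ = there (occ>0⇒∈ w occ>0)

restrict-comm : (x y : Fin n) (w : Word n) → restrict y x w ≡ restrict x y w
restrict-comm x y [] = refl
restrict-comm x y (z ∷ w) with z ≟ x | z ≟ y
... | yes _ | yes _ = cong (z ∷_) (restrict-comm x y w)
... | yes _ | no _ = cong (z ∷_) (restrict-comm x y w)
... | no _ | yes _ = cong (z ∷_) (restrict-comm x y w)
... | no _ | no _ = restrict-comm x y w

splitAt : (m : ℕ) (R : ℕ → Set) → (∀ t → t ≤ m → R t) → (∀ s → R (m + s)) → ∀ t → R t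
splitAt m R low high t with t ≤? m
... | yes t≤m = low t t≤m
... | no t≰m = subst R (m+[n∸m]≡n (<⇒≤ (≰⇒> t≰m))) (high (t ∸ m))

take-++ˡ : ∀ {A : Set} (t : ℕ) (u v : List A) → t ≤ length u → take t (u ++ v) ≡ take t u
take-++ˡ zero u v _ = refl
take-++ˡ (suc t) (z ∷ u) v (s≤s t≤u) = cong (z ∷_) (take-++ˡ t u v t≤u)

take-++ʳ : ∀ {A : Set} (s : ℕ) (u v : List A) → take (length u + s) (u ++ v) ≡ u ++ take s v
take-++ʳ s [] v = refl
take-++ʳ s (z ∷ u) v = cong (z ∷_) (take-++ʳ s u v)

take-+ : ∀ {A : Set} (c t : ℕ) (w : List A) → take (c + t) w ≡ take c w ++ take t (drop c w)
take-+ zero t w = refl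
take-+ (suc c) t [] = sym (take-[] t)
take-+ (suc c) t (z ∷ w) = cong (z ∷_) (take-+ c t w)

occTake : Fin n → ℕ → Word n → ℕ
occTake x t w = occ x (take t w)

occTake-+ : (x : Fin n) (c t : ℕ) (w : Word n) → occTake x (c + t) w ≡ occTake x c w + occTake x t (drop c w)
occTake-+ x c t w = trans (cong (occ x) (take-+ c t w)) (occ-++ x (take c w) _)

occ-take+drop : (x : Fin n) (c : ℕ) (w : Word n) → occ x (take c w) + occ x (drop c w) ≡ occ x w
occ-take+drop x c w = trans (sym (occ-++ x (take c w) (drop c w))) (cong (occ x) (take++drop≡id c w))

occTake≤occ : (x : Fin n) (t : ℕ) (w : Word n) → occTake x t w ≤ occ x w
occTake≤occ x t w = subst (occTake x t w ≤_) (occ-take+drop x t w) (m≤m+n _ _)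

occTake-absent : (x : Fin n) (B : Word n) → occ x B ≡ 0 → ∀ s → occTake x s B ≡ 0
occTake-absent x B x≡0 s = n≤0⇒n≡0 (subst (occTake x s B ≤_) x≡0 (occTake≤occ x s B))

occTake-mono : (x : Fin n) (w : Word n) {t t′ : ℕ} → t ≤ t′ → occTake x t w ≤ occTake x t′ w
occTake-mono x w {t} {t′} t≤t′ = subst (λ s → occTake x t w ≤ occTake x s w) (m+[n∸m]≡n t≤t′)
  (subst (occTake x t w ≤_) (sym (occTake-+ x t (t′ ∸ t) w)) (m≤m+n _ _))

occTake-all : (x : Fin n) (w : Word n) {t : ℕ} → length w ≤ t → occTake x t w ≡ occ x w
occTake-all x w {t} w≤t = cong (occ x) (take-all t w w≤t)

occTake-++ˡ : (x : Fin n) (u v : Word n) {t : ℕ} → t ≤ length u → occTake x t (u ++ v) ≡ occTake x t u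
occTake-++ˡ x u v {t} t≤u = cong (occ x) (take-++ˡ t u v t≤u)

occTake-++ʳ : (x : Fin n) (u v : Word n) (s : ℕ) → occTake x (length u + s) (u ++ v) ≡ occ x u + occTake x s v
occTake-++ʳ x u v s = trans (cong (occ x) (take-++ʳ s u v)) (occ-++ x u (take s v))

-- Alternation in terms of prefix counts

LeadsBy≤1 : ℕ → ℕ → Set
LeadsBy≤1 a b = b ≤ a × a ≤ suc b

Lead : Fin n → Fin n → Word n → Set
Lead x y w = ∀ t → LeadsBy≤1 (occTake x t w) (occTake y t w)

data AltFrom {n : ℕ} (x y : Fin n) : Word n → Set where
  af-[] : AltFrom x y []
  af-∷ : ∀ {r} → AltFrom y x r → AltFrom x y (x ∷ r)

lead-∷-first : {x y : Fin n} (w : Word n) → x ≢ y → Lead x y (x ∷ w) ⇔ Lead y x w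
lead-∷-first {x = x} {y} w x≢y = mk⇔ forward backward
  where
  forward : Lead x y (x ∷ w) → Lead y x w
  forward L t with L (suc t)
  ... | lo , hi rewrite occ-here x (take t w) | occ-there {x = y} (take t w) x≢y = s≤s⁻¹ hi , lo
  backward : Lead y x w → Lead x y (x ∷ w)
  backward L zero = z≤n , z≤n
  backward L (suc t) rewrite occ-here x (take t w) | occ-there {x = y} (take t w) x≢y =
    proj₂ (L t) , s≤s (proj₁ (L t))

lead-∷-other : {x y z : Fin n} (w : Word n) → z ≢ x → z ≢ y → Lead x y (z ∷ w) ⇔ Lead x y w
lead-∷-other {x = x} {y} {z} w z≢x z≢y = mk⇔ forward backward
  where
  forward : Lead x y (z ∷ w) → Lead x y w
  forward L t with L (suc t)
  ... | bounds rewrite occ-there {x = x} (take t w) z≢x | occ-there {x = y} (take t w) z≢y = bounds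
  backward : Lead x y w → Lead x y (z ∷ w)
  backward L zero = z≤n , z≤n
  backward L (suc t) rewrite occ-there {x = x} (take t w) z≢x | occ-there {x = y} (take t w) z≢y = L t

¬lead-∷-second : {x y : Fin n} (w : Word n) → x ≢ y → ¬ Lead x y (y ∷ w)
¬lead-∷-second {x = x} {y} w x≢y L with L 1
... | lo , _ rewrite occ-here y [] | occ-there {x = x} [] (x≢y ∘ sym) with lo
... | ()

lead-[] : {x y : Fin n} → Lead x y []
lead-[] zero = z≤n , z≤n
lead-[] (suc t) = z≤n , z≤n

lead⇔altFrom : (x y : Fin n) (w : Word n) → x ≢ y → Lead x y w ⇔ AltFrom x y (restrict x y w)
lead⇔altFrom x y [] x≢y = mk⇔ (λ _ → af-[]) (λ _ → lead-[])
lead⇔altFrom x y (z ∷ w) x≢y with z ≟ x | z ≟ y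
... | yes refl | yes refl = ⊥-elim (x≢y refl)
... | yes refl | no _ = mk⇔
  (λ L → af-∷ (subst (AltFrom y x) (restrict-comm x y w) (to ih (to (lead-∷-first w x≢y) L))))
  (λ { (af-∷ a) → from (lead-∷-first w x≢y) (from ih (subst (AltFrom y x) (sym (restrict-comm x y w)) a)) })
  where ih = lead⇔altFrom y x w (x≢y ∘ sym)
... | no _ | yes refl = mk⇔ (λ L → ⊥-elim (¬lead-∷-second w x≢y L)) (λ { (af-∷ _) → ⊥-elim (x≢y refl) })
... | no z≢x | no z≢y = mk⇔
  (λ L → to (lead⇔altFrom x y w x≢y) (to (lead-∷-other w z≢x z≢y) L))
  (λ a → from (lead-∷-other w z≢x z≢y) (from (lead⇔altFrom x y w x≢y) a))

alternating⇒altFrom : {x y : Fin n} (r : Word n) → All (λ z → z ≡ x ⊎ z ≡ y) r → Alternating r →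
  AltFrom x y r ⊎ AltFrom y x r
alternating⇒altFrom [] _ _ = inj₁ af-[]
alternating⇒altFrom (a ∷ []) (inj₁ refl ∷ []) _ = inj₁ (af-∷ af-[])
alternating⇒altFrom (a ∷ []) (inj₂ refl ∷ []) _ = inj₂ (af-∷ af-[])
alternating⇒altFrom {x = x} {y} (a ∷ b ∷ r) (a∈ ∷ b∷r∈) (alt-∷ .a .b a≢b alt)
  with alternating⇒altFrom {x = x} {y} (b ∷ r) b∷r∈ alt | a∈
... | inj₁ (af-∷ _) | inj₁ refl = ⊥-elim (a≢b refl)
... | inj₁ (af-∷ p) | inj₂ refl = inj₂ (af-∷ (af-∷ p))
... | inj₂ (af-∷ p) | inj₁ refl = inj₁ (af-∷ (af-∷ p))
... | inj₂ (af-∷ _) | inj₂ refl = ⊥-elim (a≢b refl)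

altFrom⇒alternating : {x y : Fin n} (r : Word n) → x ≢ y → AltFrom x y r → Alternating r
altFrom⇒alternating [] _ af-[] = alt-[]
altFrom⇒alternating (x ∷ []) _ (af-∷ af-[]) = alt-one x
altFrom⇒alternating {x = x} {y} (x ∷ y ∷ r) x≢y (af-∷ (af-∷ p)) =
  alt-∷ x y x≢y (altFrom⇒alternating (y ∷ r) (x≢y ∘ sym) (af-∷ p))

restrict-letters : (x y : Fin n) (w : Word n) → All (λ z → z ≡ x ⊎ z ≡ y) (restrict x y w)
restrict-letters x y [] = []
restrict-letters x y (z ∷ w) with z ≟ x | z ≟ y
... | yes z≡x | _ = inj₁ z≡x ∷ restrict-letters x y w
... | no _ | yes z≡y = inj₂ z≡y ∷ restrict-letters x y w
... | no _ | no _ = restrict-letters x y w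

alternate⇔lead : (x y : Fin n) (w : Word n) → x ≢ y → Alternate x y w ⇔ (Lead x y w ⊎ Lead y x w)
alternate⇔lead x y w x≢y = mk⇔ forward backward
  where
  forward : Alternate x y w → Lead x y w ⊎ Lead y x w
  forward A with alternating⇒altFrom (restrict x y w) (restrict-letters x y w) A
  ... | inj₁ a = inj₁ (from (lead⇔altFrom x y w x≢y) a)
  ... | inj₂ a = inj₂ (from (lead⇔altFrom y x w (x≢y ∘ sym)) (subst (AltFrom y x) (sym (restrict-comm x y w)) a))
  backward : Lead x y w ⊎ Lead y x w → Alternate x y w
  backward (inj₁ L) = altFrom⇒alternating (restrict x y w) x≢y (to (lead⇔altFrom x y w x≢y) L)
  backward (inj₂ L) = altFrom⇒alternating (restrict x y w) (x≢y ∘ sym)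
    (subst (AltFrom y x) (restrict-comm x y w) (to (lead⇔altFrom y x w (x≢y ∘ sym)) L))

Narrow : Fin n → Fin n → Word n → Set
Narrow x y w = ∀ t t′ → occTake x t w + occTake y t′ w ≤ occTake x t′ w + occTake y t w + 1

narrow-sym : {x y : Fin n} {w : Word n} → Narrow x y w → Narrow y x w
narrow-sym {x = x} {y} {w} N t t′ = begin
  occTake y t w + occTake x t′ w      ≡⟨ +-comm (occTake y t w) _ ⟩
  occTake x t′ w + occTake y t w      ≤⟨ N t′ t ⟩
  occTake x t w + occTake y t′ w + 1  ≡⟨ cong (_+ 1) (+-comm (occTake x t w) _) ⟩
  occTake y t′ w + occTake x t w + 1  ∎
  where open ≤-Reasoning

lead⇒narrow : {x y : Fin n} {w : Word n} → Lead x y w → Narrow x y w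
lead⇒narrow {x = x} {y} {w} L t t′ = begin
  occTake x t w + occTake y t′ w        ≤⟨ +-mono-≤ (proj₂ (L t)) (proj₁ (L t′)) ⟩
  suc (occTake y t w) + occTake x t′ w  ≡⟨ cong suc (+-comm (occTake y t w) _) ⟩
  suc (occTake x t′ w + occTake y t w)  ≡⟨ +-comm 1 _ ⟩
  occTake x t′ w + occTake y t w + 1    ∎
  where open ≤-Reasoning

narrow-of-occ≤1 : (x y : Fin n) (w : Word n) → occ x w ≤ 1 → occ y w ≤ 1 → Narrow x y w
narrow-of-occ≤1 x y w x≤1 y≤1 t t′ with t ≤? t′
... | yes t≤t′ = begin
  occTake x t w + occTake y t′ w      ≤⟨ +-mono-≤ (occTake-mono x w t≤t′) (≤-trans (occTake≤occ y t′ w) y≤1) ⟩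
  occTake x t′ w + 1                  ≤⟨ +-monoˡ-≤ 1 (m≤m+n _ _) ⟩
  occTake x t′ w + occTake y t w + 1  ∎
  where open ≤-Reasoning
... | no t≰t′ = begin
  occTake x t w + occTake y t′ w      ≤⟨ +-mono-≤ (≤-trans (occTake≤occ x t w) x≤1) (occTake-mono y w (<⇒≤ (≰⇒> t≰t′))) ⟩
  1 + occTake y t w                   ≡⟨ +-comm 1 _ ⟩
  occTake y t w + 1                   ≤⟨ +-monoˡ-≤ 1 (m≤n+m _ _) ⟩
  occTake x t′ w + occTake y t w + 1  ∎
  where open ≤-Reasoning

maxUpTo : (ℕ → ℕ) → ℕ → ℕ
maxUpTo f zero = f 0
maxUpTo f (suc T) = maxUpTo f T ⊔ f (suc T)

maxUpTo-ub : (f : ℕ → ℕ) {T t : ℕ} → t ≤ T → f t ≤ maxUpTo f T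
maxUpTo-ub f {zero} z≤n = ≤-refl
maxUpTo-ub f {suc T} {t} t≤T with t ℕ.≟ suc T
... | yes refl = m≤n⊔m (maxUpTo f T) (f (suc T))
... | no t≢T = ≤-trans (maxUpTo-ub f (s≤s⁻¹ (≤∧≢⇒< t≤T t≢T))) (m≤m⊔n _ _)

maxUpTo-attained : (f : ℕ → ℕ) (T : ℕ) → ∃ λ t → maxUpTo f T ≡ f t
maxUpTo-attained f zero = 0 , refl
maxUpTo-attained f (suc T) with ⊔-sel (maxUpTo f T) (f (suc T))
... | inj₁ e = let (t , e′) = maxUpTo-attained f T in t , trans e e′
... | inj₂ e = suc T , e

excess : Fin n → Fin n → Word n → ℕ
excess x y w = maxUpTo (λ t → occTake x t w ∸ occTake y t w) (length w)

excess-ub-prefix : (x y : Fin n) (w : Word n) {t : ℕ} → t ≤ length w →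
  occTake x t w ≤ occTake y t w + excess x y w
excess-ub-prefix x y w {t} t≤w = ≤-trans (m≤n+m∸n (occTake x t w) (occTake y t w))
  (+-monoʳ-≤ (occTake y t w) (maxUpTo-ub (λ t → occTake x t w ∸ occTake y t w) t≤w))

excess-ub : (x y : Fin n) (w : Word n) (t : ℕ) → occTake x t w ≤ occTake y t w + excess x y w
excess-ub x y w t with t ≤? length w
... | yes t≤w = excess-ub-prefix x y w t≤w
... | no t≰w = subst₂ (λ a b → a ≤ b + excess x y w) (atEnd x) (atEnd y) (excess-ub-prefix x y w ≤-refl)
  where
  atEnd : ∀ z → occTake z (length w) w ≡ occTake z t w
  atEnd z = trans (occTake-all z w ≤-refl) (sym (occTake-all z w (<⇒≤ (≰⇒> t≰w))))

excess-attained : (x y : Fin n) (w : Word n) → ∃ λ t → excess x y w ≡ occTake x t w ∸ occTake y t w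
excess-attained x y w = maxUpTo-attained (λ t → occTake x t w ∸ occTake y t w) (length w)

excess≤ : {x y : Fin n} {w : Word n} {k : ℕ} → (∀ t → occTake x t w ≤ occTake y t w + k) → excess x y w ≤ k
excess≤ {x = x} {y} {w} {k} bound =
  let (t , e) = excess-attained x y w in subst (_≤ k) (sym e) (m≤n+o⇒m∸n≤o _ _ (bound t))

excess≡0 : {x y : Fin n} {w : Word n} → (∀ t → occTake x t w ≤ occTake y t w) → excess x y w ≡ 0
excess≡0 {x = x} {y} {w} below = n≤0⇒n≡0 (excess≤ λ t → subst (occTake x t w ≤_) (sym (+-identityʳ (occTake y t w))) (below t))

excess≡0⇒ : {x y : Fin n} {w : Word n} → excess x y w ≡ 0 → ∀ t → occTake x t w ≤ occTake y t w
excess≡0⇒ {x = x} {y} {w} e t =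
  subst (occTake x t w ≤_) (trans (cong (occTake y t w +_) e) (+-identityʳ _)) (excess-ub x y w t)

excess-monoˡ : {x x′ y : Fin n} {w : Word n} → (∀ t → occTake x t w ≤ occTake x′ t w) → excess x y w ≤ excess x′ y w
excess-monoˡ {x′ = x′} {y} {w} le = excess≤ λ t → ≤-trans (le t) (excess-ub x′ y w t)

excess-antiʳ : {x y y′ : Fin n} {w : Word n} → (∀ t → occTake y t w ≤ occTake y′ t w) → excess x y′ w ≤ excess x y w
excess-antiʳ {x = x} {y} {w = w} le = excess≤ λ t → ≤-trans (excess-ub x y w t) (+-monoˡ-≤ _ (le t))

excess-lipˡ : {x x′ y : Fin n} {w : Word n} → (∀ t → occTake x′ t w ≤ suc (occTake x t w)) →
  excess x′ y w ≤ suc (excess x y w)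
excess-lipˡ {x = x} {y = y} {w} le = excess≤ λ t →
  ≤-trans (le t) (≤-trans (s≤s (excess-ub x y w t)) (≤-reflexive (sym (+-suc _ _))))

excess-lipʳ : {x y y′ : Fin n} {w : Word n} → (∀ t → occTake y′ t w ≤ suc (occTake y t w)) →
  excess x y w ≤ suc (excess x y′ w)
excess-lipʳ {x = x} {y′ = y′} {w} le = excess≤ λ t →
  ≤-trans (excess-ub x y′ w t) (≤-trans (+-monoˡ-≤ _ (le t)) (≤-reflexive (sym (+-suc _ _))))

narrow-upper : {x y : Fin n} {w : Word n} → Narrow x y w → ∀ t → occTake x t w ≤ suc (occTake y t w)
narrow-upper {y = y} {w} N t = subst₂ _≤_ (+-identityʳ _) (+-comm (occTake y t w) 1) (N t 0)

narrow-lower : {x y : Fin n} {w : Word n} {t₀ : ℕ} → Narrow x y w → occTake y t₀ w < occTake x t₀ w →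
  ∀ t → occTake y t w ≤ occTake x t w
narrow-lower {x = x} {y} {w} {t₀} N y<x t = +-cancelˡ-≤ (suc (occTake y t₀ w)) _ _ (begin
  suc (occTake y t₀ w) + occTake y t w  ≤⟨ +-monoˡ-≤ _ y<x ⟩
  occTake x t₀ w + occTake y t w        ≤⟨ N t₀ t ⟩
  occTake x t w + occTake y t₀ w + 1    ≡⟨ solve 2 (λ a b → a :+ b :+ con 1 := con 1 :+ b :+ a) refl (occTake x t w) _ ⟩
  suc (occTake y t₀ w) + occTake x t w  ∎)
  where
  open ≤-Reasoning
  open +-*-Solver

narrow⇒lead : {x y : Fin n} {w : Word n} → Narrow x y w → Lead x y w ⊎ Lead y x w
narrow⇒lead {x = x} {y} {w} N with excess-attained x y w
... | t₀ , e with occTake y t₀ w <? occTake x t₀ w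
...   | yes y<x = inj₁ λ t → narrow-lower {t₀ = t₀} N y<x t , narrow-upper N t
...   | no y≮x = inj₂ λ t → excess≡0⇒ (trans e (m≤n⇒m∸n≡0 (≮⇒≥ y≮x))) t , narrow-upper (narrow-sym N) t

alternate⇔narrow : (x y : Fin n) (w : Word n) → x ≢ y → Alternate x y w ⇔ Narrow x y w
alternate⇔narrow x y w x≢y = mk⇔
  (λ A → [ lead⇒narrow , narrow-sym ∘ lead⇒narrow ]′ (to (alternate⇔lead x y w x≢y) A))
  (λ N → from (alternate⇔lead x y w x≢y) (narrow⇒lead N))

lead⇒excess≤1 : {x y : Fin n} {w : Word n} → Lead x y w → excess x y w ≤ 1
lead⇒excess≤1 {x = x} {y} {w} L = excess≤ λ t → subst (occTake x t w ≤_) (+-comm 1 (occTake y t w)) (proj₂ (L t))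

lead⇒excess≡0 : {x y : Fin n} {w : Word n} → Lead x y w → excess y x w ≡ 0
lead⇒excess≡0 L = excess≡0 (proj₁ ∘ L)

narrow⇔excess≤1 : (x y : Fin n) (w : Word n) → Narrow x y w ⇔ excess x y w + excess y x w ≤ 1
narrow⇔excess≤1 x y w = mk⇔ forward backward
  where
  forward : Narrow x y w → excess x y w + excess y x w ≤ 1
  forward N with narrow⇒lead N
  ... | inj₁ L rewrite lead⇒excess≡0 L = subst (_≤ 1) (sym (+-identityʳ _)) (lead⇒excess≤1 L)
  ... | inj₂ L rewrite lead⇒excess≡0 L = lead⇒excess≤1 L
  backward : excess x y w + excess y x w ≤ 1 → Narrow x y w
  backward sum≤1 t t′ = begin
    occTake x t w + occTake y t′ w
      ≤⟨ +-mono-≤ (excess-ub x y w t) (excess-ub y x w t′) ⟩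
    (occTake y t w + excess x y w) + (occTake x t′ w + excess y x w)
      ≡⟨ solve 4 (λ a b c d → (a :+ b) :+ (c :+ d) := c :+ a :+ (b :+ d)) refl (occTake y t w) _ (occTake x t′ w) _ ⟩
    occTake x t′ w + occTake y t w + (excess x y w + excess y x w)
      ≤⟨ +-monoʳ-≤ _ sum≤1 ⟩
    occTake x t′ w + occTake y t w + 1 ∎
    where
    open ≤-Reasoning
    open +-*-Solver

equalPrefixOcc⇒absent : (x y : Fin n) (w : Word n) → x ≢ y → (∀ t → occTake x t w ≡ occTake y t w) → occ x w ≡ 0
equalPrefixOcc⇒absent x y [] x≢y eq = refl
equalPrefixOcc⇒absent x y (z ∷ w) x≢y eq with z ≟ x | z ≟ y | eq 1
... | yes refl | yes refl | _ = ⊥-elim (x≢y refl)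
... | yes refl | no _ | ()
... | no _ | yes refl | ()
... | no z≢x | no z≢y | _ = equalPrefixOcc⇒absent x y w x≢y λ t →
  trans (sym (occ-there (take t w) z≢x)) (trans (eq (suc t)) (occ-there (take t w) z≢y))

excess-sum>0 : (x y : Fin n) (w : Word n) → x ≢ y → x ∈ w → 0 < excess x y w + excess y x w
excess-sum>0 x y w x≢y x∈w with excess x y w in exy | excess y x w in eyx
... | suc _ | _ = z<s
... | zero | suc _ = z<s
... | zero | zero = ⊥-elim (<-irrefl (sym absent) (∈⇒occ>0 x∈w))
  where
  absent : occ x w ≡ 0
  absent = equalPrefixOcc⇒absent x y w x≢y λ t → ≤-antisym (excess≡0⇒ exy t) (excess≡0⇒ eyx t)

-- Rotations of uniform words

represents-transfer : {G : Graph n} {w w′ : Word n} → (∀ x → x ∈ w′) →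
  (∀ x y → x ≢ y → Alternate x y w′ ⇔ Alternate x y w) → Represents w G → Represents w′ G
represents-transfer mem′ same (_ , alt) = mem′ , λ x y x≢y → ⇔-trans (same x y x≢y) (alt x y x≢y)

represents-via-narrow : {G : Graph n} {w w′ : Word n} → (∀ x → x ∈ w′) →
  (∀ x y → Narrow x y w′ ⇔ Narrow x y w) → Represents w G → Represents w′ G
represents-via-narrow {G = G} {w} {w′} mem′ same = represents-transfer {G = G} mem′ λ x y x≢y →
  ⇔-trans (alternate⇔narrow x y w′ x≢y) (⇔-trans (same x y) (⇔-sym (alternate⇔narrow x y w x≢y)))

rotate : ℕ → Word n → Word n
rotate c w = drop c w ++ take c w

occ-rotate : (x : Fin n) (c : ℕ) (w : Word n) → occ x (rotate c w) ≡ occ x w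
occ-rotate x c w = trans (occ-++ x (drop c w) (take c w)) (trans (+-comm (occ x (drop c w)) _) (occ-take+drop x c w))

uniform-rotate : {k : ℕ} {w : Word n} (c : ℕ) → Uniform k w → Uniform k (rotate c w)
uniform-rotate {w = w} c U x = trans (occ-rotate x c w) (U x)

rotate-back : (c : ℕ) (w : Word n) → rotate (length (drop c w)) (rotate c w) ≡ w
rotate-back c w = trans (cong₂ _++_ (drop-++ (drop c w) (take c w)) (take-++ (drop c w) (take c w))) (take++drop≡id c w)
  where
  drop-++ : ∀ {A : Set} (u v : List A) → drop (length u) (u ++ v) ≡ v
  drop-++ [] v = refl
  drop-++ (z ∷ u) v = drop-++ u v
  take-++ : ∀ {A : Set} (u v : List A) → take (length u) (u ++ v) ≡ u
  take-++ u v = trans (take-++ˡ (length u) u v ≤-refl) (take-all (length u) u ≤-refl)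

occTake-rotate-low : (x : Fin n) (w : Word n) (c t : ℕ) → t ≤ length (drop c w) →
  occTake x t (rotate c w) + occTake x c w ≡ occTake x (c + t) w
occTake-rotate-low x w c t t≤ = begin
  occTake x t (rotate c w) + occTake x c w  ≡⟨ cong (_+ occTake x c w) (occTake-++ˡ x (drop c w) (take c w) t≤) ⟩
  occTake x t (drop c w) + occTake x c w    ≡⟨ +-comm (occTake x t (drop c w)) _ ⟩
  occTake x c w + occTake x t (drop c w)    ≡⟨ occTake-+ x c t w ⟨
  occTake x (c + t) w                       ∎
  where open ≡-Reasoning

occTake-rotate-high : (x : Fin n) (w : Word n) (c s : ℕ) →
  occTake x (length (drop c w) + s) (rotate c w) + occTake x c w ≡ occTake x (s ⊓ c) w + occ x w
occTake-rotate-high x w c s = begin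
  occTake x (length (drop c w) + s) (rotate c w) + occTake x c w
    ≡⟨ cong (_+ occTake x c w) (occTake-++ʳ x (drop c w) (take c w) s) ⟩
  occ x (drop c w) + occTake x s (take c w) + occTake x c w
    ≡⟨ cong (λ u → occ x (drop c w) + occ x u + occTake x c w) (take-take s c w) ⟩
  occ x (drop c w) + occTake x (s ⊓ c) w + occTake x c w
    ≡⟨ solve 3 (λ d m t → d :+ m :+ t := m :+ (t :+ d)) refl (occ x (drop c w)) (occTake x (s ⊓ c) w) _ ⟩
  occTake x (s ⊓ c) w + (occTake x c w + occ x (drop c w))
    ≡⟨ cong (occTake x (s ⊓ c) w +_) (occ-take+drop x c w) ⟩
  occTake x (s ⊓ c) w + occ x w ∎
  where
  open ≡-Reasoning
  open +-*-Solver

-- A prefix of the rotation followed by the cut-off part counts like a prefix of w,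
-- up to one full copy (e = 0 or e = k) of every letter.
occTake-rotate : {k : ℕ} (w : Word n) → Uniform k w → (c t : ℕ) →
  ∃₂ λ τ e → ∀ x → occTake x t (rotate c w) + occTake x c w ≡ occTake x τ w + e
occTake-rotate {k = k} w U c t with t ≤? length (drop c w)
... | yes t≤ = c + t , 0 , λ x → trans (occTake-rotate-low x w c t t≤) (sym (+-identityʳ _))
... | no t≰ = s ⊓ c , k , λ x → begin
  occTake x t (rotate c w) + occTake x c w                     ≡⟨ cong (λ t → occTake x t (rotate c w) + occTake x c w) t≡ ⟩
  occTake x (length (drop c w) + s) (rotate c w) + occTake x c w ≡⟨ occTake-rotate-high x w c s ⟩
  occTake x (s ⊓ c) w + occ x w                              ≡⟨ cong (occTake x (s ⊓ c) w +_) (U x) ⟩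
  occTake x (s ⊓ c) w + k                                     ∎
  where
  open ≡-Reasoning
  s = t ∸ length (drop c w)
  t≡ : t ≡ length (drop c w) + s
  t≡ = sym (m+[n∸m]≡n (<⇒≤ (≰⇒> t≰)))

narrow-rotate : {k : ℕ} {x y : Fin n} (w : Word n) → Uniform k w → (c : ℕ) → Narrow x y w → Narrow x y (rotate c w)
narrow-rotate {x = x} {y} w U c N t t′ =
  let (τ , e , h) = occTake-rotate w U c t ; (τ′ , e′ , h′) = occTake-rotate w U c t′ in
  +-cancelʳ-≤ (occTake x c w + occTake y c w) _ _ (begin
    occTake x t r + occTake y t′ r + (occTake x c w + occTake y c w)
      ≡⟨ solve 4 (λ a b c d → a :+ b :+ (c :+ d) := (a :+ c) :+ (b :+ d)) refl (occTake x t r) _ _ _ ⟩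
    (occTake x t r + occTake x c w) + (occTake y t′ r + occTake y c w)
      ≡⟨ cong₂ _+_ (h x) (h′ y) ⟩
    (occTake x τ w + e) + (occTake y τ′ w + e′)
      ≡⟨ solve 4 (λ a b c d → (a :+ b) :+ (c :+ d) := (a :+ c) :+ (b :+ d)) refl (occTake x τ w) e _ e′ ⟩
    (occTake x τ w + occTake y τ′ w) + (e + e′)
      ≤⟨ +-monoˡ-≤ (e + e′) (N τ τ′) ⟩
    (occTake x τ′ w + occTake y τ w + 1) + (e + e′)
      ≡⟨ solve 4 (λ a b c d → (a :+ b :+ con 1) :+ (c :+ d) := (a :+ d) :+ (b :+ c) :+ con 1) refl (occTake x τ′ w) _ e e′ ⟩
    (occTake x τ′ w + e′) + (occTake y τ w + e) + 1
      ≡⟨ cong (_+ 1) (cong₂ _+_ (h′ x) (h y)) ⟨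
    (occTake x t′ r + occTake x c w) + (occTake y t r + occTake y c w) + 1
      ≡⟨ solve 4 (λ a b c d → (a :+ b) :+ (c :+ d) :+ con 1 := a :+ c :+ con 1 :+ (b :+ d)) refl (occTake x t′ r) _ _ _ ⟩
    occTake x t′ r + occTake y t r + 1 + (occTake x c w + occTake y c w) ∎)
  where
  open ≤-Reasoning
  open +-*-Solver
  r = rotate c w

represents-rotate : {k : ℕ} {G : Graph n} (w : Word n) → Uniform k w → (c : ℕ) → Represents w G → Represents (rotate c w) G
represents-rotate {G = G} w U c rep@(mem , _) = represents-via-narrow {G = G}
  (λ x → occ>0⇒∈ (rotate c w) (subst (0 <_) (sym (occ-rotate x c w)) (∈⇒occ>0 (mem x))))
  (λ x y → mk⇔ (λ N → subst (Narrow x y) (rotate-back c w) (narrow-rotate (rotate c w) (uniform-rotate c U) (length (drop c w)) N))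
               (narrow-rotate w U c))
  rep

sum-mono-≤ : {f g : Fin n → ℕ} → (∀ i → f i ≤ g i) → sum f ≤ sum g
sum-mono-≤ {zero} le = z≤n
sum-mono-≤ {suc n} le = +-mono-≤ (le Fin.zero) (sum-mono-≤ (le ∘ Fin.suc))

sum-mono-< : {f g : Fin n → ℕ} → (∀ i → f i ≤ g i) → (j : Fin n) → f j < g j → sum f < sum g
sum-mono-< le Fin.zero lt = +-mono-<-≤ lt (sum-mono-≤ (le ∘ Fin.suc))
sum-mono-< le (Fin.suc j) lt = +-mono-≤-< (le Fin.zero) (sum-mono-< (le ∘ Fin.suc) j lt)

sum-const : (v : ℕ) → sum {n} (λ _ → v) ≡ n * v
sum-const {zero} v = refl
sum-const {suc n} v = cong (v +_) (sum-const {n} v)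

bit : {P : Set} → Dec P → ℕ
bit (yes _) = 1
bit (no _) = 0

bit-yes : {P : Set} (d : Dec P) → P → bit d ≡ 1
bit-yes (yes _) _ = refl
bit-yes (no ¬p) p = ⊥-elim (¬p p)

bit≡1⇒ : {P : Set} (d : Dec P) → bit d ≡ 1 → P
bit≡1⇒ (yes p) _ = p

bit-no : {P : Set} (d : Dec P) → ¬ P → bit d ≡ 0
bit-no (yes p) ¬p = ⊥-elim (¬p p)
bit-no (no _) _ = refl

bit≤1 : {P : Set} (d : Dec P) → bit d ≤ 1
bit≤1 (yes _) = ≤-refl
bit≤1 (no _) = z≤n

bit-cases : {P : Set} (d : Dec P) → bit d ≡ 0 ⊎ bit d ≡ 1
bit-cases (yes _) = inj₂ refl
bit-cases (no _) = inj₁ refl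

indicator : Fin n → Fin n → ℕ
indicator z x = bit (z ≟ x)

indicator-self : (x : Fin n) → indicator x x ≡ 1
indicator-self x = bit-yes (x ≟ x) refl

indicator-other : {x y : Fin n} → x ≢ y → indicator x y ≡ 0
indicator-other {x = x} {y} = bit-no (x ≟ y)

sum-indicator : (z : Fin n) → sum (indicator z) ≡ 1
sum-indicator {suc n} Fin.zero = cong suc (trans (sum-cong-≗ {n} not0) (sum-replicate-zero n))
  where
  not0 : ∀ i → indicator Fin.zero (Fin.suc i) ≡ 0
  not0 i = refl
sum-indicator {suc n} (Fin.suc z) = trans (sum-cong-≗ shift) (sum-indicator z)
  where
  shift : ∀ i → indicator (Fin.suc z) (Fin.suc i) ≡ indicator z i
  shift i with z ≟ i
  ... | yes refl = refl
  ... | no _ = refl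

occ-∷ : (x z : Fin n) (u : Word n) → occ x (z ∷ u) ≡ indicator z x + occ x u
occ-∷ x z u with z ≟ x
... | yes _ = refl
... | no _ = refl

sum-occ : (u : Word n) → sum (λ x → occ x u) ≡ length u
sum-occ {n} [] = sum-replicate-zero n
sum-occ (z ∷ u) = begin
  sum (λ x → occ x (z ∷ u))                 ≡⟨ sum-cong-≗ (λ x → occ-∷ x z u) ⟩
  sum (λ x → indicator z x + occ x u)        ≡⟨ ∑-distrib-+ (indicator z) (λ x → occ x u) ⟩
  sum (indicator z) + sum (λ x → occ x u)   ≡⟨ cong₂ _+_ (sum-indicator z) (sum-occ u) ⟩
  suc (length u)                           ∎
  where open ≡-Reasoning

module ClassSum {n : ℕ} (c : Fin n → Bool) where

  onClass : Bool → (Fin n → ℕ) → Fin n → ℕ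
  onClass b f x = if does (c x Bool.≟ b) then f x else 0

  classSum : Bool → (Fin n → ℕ) → ℕ
  classSum b f = sum (onClass b f)

  classSize : Bool → ℕ
  classSize b = classSum b (λ _ → 1)

  module _ {b : Bool} where

    classSum-cong : {f g : Fin n → ℕ} → (∀ x → c x ≡ b → f x ≡ g x) → classSum b f ≡ classSum b g
    classSum-cong {f} {g} eq = sum-cong-≗ pointwise
      where
      pointwise : ∀ x → onClass b f x ≡ onClass b g x
      pointwise x with c x Bool.≟ b
      ... | yes cx = eq x cx
      ... | no _ = refl

    classSum-mono : {f g : Fin n → ℕ} → (∀ x → c x ≡ b → f x ≤ g x) → classSum b f ≤ classSum b g
    classSum-mono le = sum-mono-≤ (pointwise le)
      where
      pointwise : {f g : Fin n → ℕ} → (∀ x → c x ≡ b → f x ≤ g x) → ∀ x → onClass b f x ≤ onClass b g x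
      pointwise le x with c x Bool.≟ b
      ... | yes cx = le x cx
      ... | no _ = z≤n

    classSum-< : {f g : Fin n → ℕ} → (∀ x → c x ≡ b → f x ≤ g x) →
      (z : Fin n) → c z ≡ b → f z < g z → classSum b f < classSum b g
    classSum-< {f} {g} le z cz lt = sum-mono-< pointwise z atZ
      where
      pointwise : ∀ x → onClass b f x ≤ onClass b g x
      pointwise x with c x Bool.≟ b
      ... | yes cx = le x cx
      ... | no _ = z≤n
      atZ : onClass b f z < onClass b g z
      atZ with c z Bool.≟ b
      ... | yes _ = lt
      ... | no cz≢b = ⊥-elim (cz≢b cz)

    classSum-+ : (f g : Fin n → ℕ) → classSum b (λ x → f x + g x) ≡ classSum b f + classSum b g
    classSum-+ f g = trans (sum-cong-≗ pointwise) (∑-distrib-+ (onClass b f) (onClass b g))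
      where
      pointwise : ∀ x → onClass b (λ x → f x + g x) x ≡ onClass b f x + onClass b g x
      pointwise x with c x Bool.≟ b
      ... | yes _ = refl
      ... | no _ = refl

    classSum-const : (v : ℕ) → classSum b (λ _ → v) ≡ v * classSize b
    classSum-const v = trans (sum-cong-≗ pointwise) (sym (*-distribˡ-sum v (onClass b (λ _ → 1))))
      where
      pointwise : ∀ x → onClass b (λ _ → v) x ≡ v * onClass b (λ _ → 1) x
      pointwise x with c x Bool.≟ b
      ... | yes _ = sym (*-identityʳ v)
      ... | no _ = sym (*-zeroʳ v)

    classSum-indicator : (z : Fin n) → c z ≡ b → classSum b (indicator z) ≡ 1
    classSum-indicator z cz = trans (sum-cong-≗ pointwise) (sum-indicator z)
      where
      pointwise : ∀ x → onClass b (indicator z) x ≡ indicator z x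
      pointwise x with c x Bool.≟ b | z ≟ x
      ... | yes _ | _ = refl
      ... | no _ | no _ = refl
      ... | no cx≢b | yes refl = ⊥-elim (cx≢b cz)

    classSum≤sum : (f : Fin n → ℕ) → classSum b f ≤ sum f
    classSum≤sum f = sum-mono-≤ pointwise
      where
      pointwise : ∀ x → onClass b f x ≤ f x
      pointwise x with c x Bool.≟ b
      ... | yes _ = ≤-refl
      ... | no _ = z≤n

    classSize≤n : classSize b ≤ n
    classSize≤n = subst (classSize b ≤_) (trans (sum-const {n} 1) (*-identityʳ n)) (classSum≤sum (λ _ → 1))

    classSum-between : (f : Fin n → ℕ) (v : ℕ) → (∀ x → c x ≡ b → v ≤ f x × f x ≤ suc v) →
      (z : Fin n) → c z ≡ b → f z ≡ v → v * classSize b ≤ classSum b f × classSum b f < suc v * classSize b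
    classSum-between f v between z cz fz =
      subst (_≤ classSum _ f) (classSum-const v) (classSum-mono (λ x cx → proj₁ (between x cx))) ,
      subst (classSum _ f <_) (classSum-const (suc v))
        (classSum-< (λ x cx → proj₂ (between x cx)) z cz (subst (_< suc v) (sym fz) ≤-refl))

  classSum-split : (f : Fin n → ℕ) → classSum true f + classSum false f ≡ sum f
  classSum-split f = trans (sym (∑-distrib-+ (onClass true f) (onClass false f))) (sum-cong-≗ pointwise)
    where
    pointwise : ∀ x → onClass true f x + onClass false f x ≡ f x
    pointwise x with c x
    ... | true = +-identityʳ (f x)
    ... | false = refl

-- Words containing every letter once, and permutation graphs

indicator< : ℕ → ℕ → ℕ
indicator< a t = bit (a <? t)

indicator<-yes : {a t : ℕ} → a < t → indicator< a t ≡ 1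
indicator<-yes {a} {t} = bit-yes (a <? t)

indicator<-no : {a t : ℕ} → t ≤ a → indicator< a t ≡ 0
indicator<-no {a} {t} t≤a = bit-no (a <? t) (≤⇒≯ t≤a)

indicator<≤1 : (a t : ℕ) → indicator< a t ≤ 1
indicator<≤1 a t = bit≤1 (a <? t)

indicator<-anti : {a b : ℕ} (t : ℕ) → a ≤ b → indicator< b t ≤ indicator< a t
indicator<-anti {a} {b} t a≤b with b <? t
... | yes b<t = ≤-reflexive (sym (indicator<-yes (≤-<-trans a≤b b<t)))
... | no _ = z≤n

indicator<-interleave : {a b : ℕ} (t : ℕ) → a < b → LeadsBy≤1 (indicator< a t) (indicator< b t)
indicator<-interleave t a<b = indicator<-anti t (<⇒≤ a<b) , ≤-trans (indicator<≤1 _ t) (s≤s z≤n)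

opposite-<⇔ : (a b : Fin n) → toℕ (opposite a) < toℕ (opposite b) ⇔ toℕ b < toℕ a
opposite-<⇔ {n} a b = mk⇔
  (λ lt → s≤s⁻¹ (∸-cancelʳ-< {suc (toℕ a)} {suc (toℕ b)} {n} (subst₂ _<_ (opposite-prop a) (opposite-prop b) lt)))
  (λ lt → subst₂ _<_ (sym (opposite-prop a)) (sym (opposite-prop b)) (∸-monoʳ-< (s≤s lt) (toℕ<n a)))

complete⇒permutationGraph : (G : Graph n) → (∀ x y → x ≢ y → Adjacent G x y) → PermutationGraph G
complete⇒permutationGraph G complete = Perm.id , reverse , λ u v u<v → mk⇔
  (λ _ → from (opposite-<⇔ v u) u<v)
  (λ _ → complete u v (λ u≡v → <-irrefl (cong toℕ u≡v) u<v))

occ≤occ-∷ : (x z : Fin n) (w : Word n) → occ x w ≤ occ x (z ∷ w)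
occ≤occ-∷ x z w = subst (occ x w ≤_) (sym (occ-∷ x z w)) (m≤n+m _ _)

repeated⇒occ>1 : {x : Fin n} {P : Word n} → x ∈ P → 1 < occ x (x ∷ P)
repeated⇒occ>1 {x = x} {P} x∈P = subst (1 <_) (sym (occ-here x P)) (s≤s (∈⇒occ>0 x∈P))

lookup-unique : (P : Word n) (i j : Fin (length P)) → occ (lookup P i) P ≤ 1 → lookup P i ≡ lookup P j → i ≡ j
lookup-unique (z ∷ P) Fin.zero Fin.zero _ _ = refl
lookup-unique (z ∷ P) Fin.zero (Fin.suc j) once z≡ =
  ⊥-elim (<⇒≱ (repeated⇒occ>1 (subst (_∈ P) (sym z≡) (∈-lookup {xs = P} j))) once)
lookup-unique (z ∷ P) (Fin.suc i) Fin.zero once ≡z =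
  ⊥-elim (<⇒≱ (repeated⇒occ>1 (subst (_∈ P) ≡z (∈-lookup {xs = P} i))) (subst (λ y → occ y (z ∷ P) ≤ 1) ≡z once))
lookup-unique (z ∷ P) (Fin.suc i) (Fin.suc j) once e =
  cong Fin.suc (lookup-unique P i j (≤-trans (occ≤occ-∷ _ z P) once) e)

∈-take : {x : Fin n} {P : Word n} {t : ℕ} (p : x ∈ P) → toℕ (index p) < t → x ∈ take t P
∈-take {t = suc t} (here e) _ = here e
∈-take {t = suc t} (there p) (s≤s lt) = there (∈-take p lt)

∈-drop : {x : Fin n} {P : Word n} {t : ℕ} (p : x ∈ P) → t ≤ toℕ (index p) → x ∈ drop t P
∈-drop {t = zero} p _ = p
∈-drop {t = suc t} (there p) (s≤s le) = ∈-drop p le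

module OnceWord {n : ℕ} (P : Word n) (once : ∀ x → occ x P ≡ 1) where

  length≡n : length P ≡ n
  length≡n = trans (sym (sum-occ P)) (trans (sum-cong-≗ once) (trans (sum-const {n} 1) (*-identityʳ n)))

  member : ∀ x → x ∈ P
  member x = occ>0⇒∈ P (subst (0 <_) (sym (once x)) z<s)

  position : Fin n → Fin n
  position x = cast length≡n (index (member x))

  letterAt : Fin n → Fin n
  letterAt i = lookup P (cast (sym length≡n) i)

  letterAt-position : ∀ x → letterAt (position x) ≡ x
  letterAt-position x =
    trans (cong (lookup P) (cast-involutive (sym length≡n) length≡n _)) (sym (lookup-index (member x)))

  position-letterAt : ∀ i → position (letterAt i) ≡ i
  position-letterAt i = trans (cong (cast length≡n) sameIndex) (cast-involutive length≡n (sym length≡n) i)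
    where
    sameIndex : index (member (letterAt i)) ≡ cast (sym length≡n) i
    sameIndex = lookup-unique P _ _ (≤-reflexive (once _)) (sym (lookup-index (member (letterAt i))))

  permutation′ : Permutation′ n
  permutation′ = permutation position letterAt position-letterAt letterAt-position

  position-injective : ∀ {x y} → toℕ (position x) ≡ toℕ (position y) → x ≡ y
  position-injective {x} {y} e = trans (sym (letterAt-position x)) (trans (cong letterAt (toℕ-injective e)) (letterAt-position y))

  occTake-once : ∀ x t → occTake x t P ≡ indicator< (toℕ (position x)) t
  occTake-once x t with toℕ (position x) <? t
  ... | yes before = ≤-antisym (subst (occTake x t P ≤_) (once x) (occTake≤occ x t P))
                       (∈⇒occ>0 (∈-take (member x) (subst (_< t) (toℕ-cast length≡n _) before)))
  ... | no notBefore = n≤0⇒n≡0 (+-cancelʳ-≤ 1 _ 0 (begin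
    occTake x t P + 1                 ≤⟨ +-monoʳ-≤ _ (∈⇒occ>0 (∈-drop (member x) later)) ⟩
    occTake x t P + occ x (drop t P)  ≡⟨ occ-take+drop x t P ⟩
    occ x P                           ≡⟨ once x ⟩
    1                                 ∎))
    where
    open ≤-Reasoning
    later : t ≤ toℕ (index (member x))
    later = subst (t ≤_) (toℕ-cast length≡n _) (≮⇒≥ notBefore)

module TwoPermutations {n : ℕ} (P Q : Word n) (onceP : ∀ x → occ x P ≡ 1) (onceQ : ∀ x → occ x Q ≡ 1) where

  module OP = OnceWord P onceP
  module OQ = OnceWord Q onceQ

  σ τ : Fin n → ℕ
  σ x = toℕ (OP.position x)
  τ x = toℕ (OQ.position x)

  occTake-firstHalf : ∀ x {t} → t ≤ n → occTake x t (P ++ Q) ≡ indicator< (σ x) t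
  occTake-firstHalf x {t} t≤n = trans (occTake-++ˡ x P Q (subst (t ≤_) (sym OP.length≡n) t≤n)) (OP.occTake-once x t)

  occTake-secondHalf : ∀ x s → occTake x (n + s) (P ++ Q) ≡ suc (indicator< (τ x) s)
  occTake-secondHalf x s = begin
    occTake x (n + s) (P ++ Q)         ≡⟨ cong (λ m → occTake x (m + s) (P ++ Q)) (sym OP.length≡n) ⟩
    occTake x (length P + s) (P ++ Q)  ≡⟨ occTake-++ʳ x P Q s ⟩
    occ x P + occTake x s Q            ≡⟨ cong₂ _+_ (onceP x) (OQ.occTake-once x s) ⟩
    suc (indicator< (τ x) s)           ∎
    where open ≡-Reasoning

  lead⇔sameOrder : ∀ u v → σ u < σ v → (Lead u v (P ++ Q) ⊎ Lead v u (P ++ Q)) ⇔ τ u < τ v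
  lead⇔sameOrder u v σu<σv = mk⇔ forward (λ τu<τv → inj₁ (splitAt n Bounds (firstHalf) (secondHalf τu<τv)))
    where
    W = P ++ Q
    Bounds : ℕ → Set
    Bounds t = LeadsBy≤1 (occTake u t W) (occTake v t W)
    firstHalf : ∀ t → t ≤ n → Bounds t
    firstHalf t t≤n rewrite occTake-firstHalf u t≤n | occTake-firstHalf v t≤n = indicator<-interleave t σu<σv
    secondHalf : τ u < τ v → ∀ s → Bounds (n + s)
    secondHalf τu<τv s rewrite occTake-secondHalf u s | occTake-secondHalf v s =
      let (lo , hi) = indicator<-interleave s τu<τv in s≤s lo , s≤s hi
    σu<n : suc (σ u) ≤ n
    σu<n = <-≤-trans σu<σv (<⇒≤ (toℕ<n (OP.position v)))
    forward : Lead u v W ⊎ Lead v u W → τ u < τ v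
    forward (inj₂ L) with L (suc (σ u))
    ... | u≤v , _ rewrite occTake-firstHalf u σu<n | occTake-firstHalf v σu<n
                        | indicator<-yes (n<1+n (σ u)) | indicator<-no σu<σv with u≤v
    ... | ()
    forward (inj₁ L) with τ u <? τ v
    ... | yes τu<τv = τu<τv
    ... | no τu≮τv with τ v ℕ.≟ τ u
    ...   | yes τv≡τu = ⊥-elim (<-irrefl (cong σ (OQ.position-injective (sym τv≡τu))) σu<σv)
    ...   | no τv≢τu with L (n + suc (τ v))
    ...     | v≤u , _ rewrite occTake-secondHalf u (suc (τ v)) | occTake-secondHalf v (suc (τ v))
                            | indicator<-yes (n<1+n (τ v)) | indicator<-no (≤∧≢⇒< (≮⇒≥ τu≮τv) τv≢τu) with v≤u
    ...       | s≤s ()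

  permutationGraph : (G : Graph n) → Represents (P ++ Q) G → PermutationGraph G
  permutationGraph G (_ , alt) = OP.permutation′ , flip OP.permutation′ ∘ₚ OQ.permutation′ ∘ₚ reverse ,
    λ u v σu<σv → let u≢v = λ u≡v → <-irrefl (cong σ u≡v) σu<σv in
      ⇔-trans (⇔-sym (alt u v u≢v))
      (⇔-trans (alternate⇔lead u v (P ++ Q) u≢v)
      (⇔-trans (lead⇔sameOrder u v σu<σv)
      (⇔-trans (⇔-sym (opposite-<⇔ (OQ.position v) (OQ.position u)))
        (mk⇔ (subst₂ reversedOrder (sym (OP.letterAt-position v)) (sym (OP.letterAt-position u)))
             (subst₂ reversedOrder (OP.letterAt-position v) (OP.letterAt-position u))))))
    where
    reversedOrder : Fin n → Fin n → Set
    reversedOrder a b = toℕ (opposite (OQ.position a)) < toℕ (opposite (OQ.position b))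

-- One- and two-representable co-bipartite graphs

ComplementColouring : Graph n → (Fin n → Bool) → Set
ComplementColouring {n} G c = ∀ (x y : Fin n) → x ≢ y → adj G x y ≡ false → c x ≢ c y

sameColour⇒adjacent : {G : Graph n} {c : Fin n → Bool} → ComplementColouring G c →
  ∀ {x y} → x ≢ y → c x ≡ c y → Adjacent G x y
sameColour⇒adjacent {G = G} cb {x} {y} x≢y cx≡cy with adj G x y in e
... | true = refl
... | false = ⊥-elim (cb x y x≢y e cx≡cy)

sameColour⇒narrow : {G : Graph n} {c : Fin n → Bool} {w : Word n} → Represents w G → ComplementColouring G c →
  ∀ {x y} → x ≢ y → c x ≡ c y → Narrow x y w
sameColour⇒narrow {G = G} {w = w} (_ , alt) cb {x} {y} x≢y cx≡cy =
  to (alternate⇔narrow x y w x≢y) (from (alt x y x≢y) (sameColour⇒adjacent {G = G} cb x≢y cx≡cy))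

sameColour⇒occTake≤suc : {G : Graph n} {c : Fin n → Bool} {w : Word n} → Represents w G → ComplementColouring G c →
  ∀ {x y} → c x ≡ c y → ∀ t → occTake x t w ≤ suc (occTake y t w)
sameColour⇒occTake≤suc {G = G} {w = w} rep cb {x} {y} cx≡cy t with x ≟ y
... | yes refl = n≤1+n _
... | no x≢y = narrow-upper (sameColour⇒narrow {G = G} rep cb x≢y cx≡cy) t

oneRepresentable⇒permutationGraph : (G : Graph n) → KRepresentable 1 G → PermutationGraph G
oneRepresentable⇒permutationGraph G (w , U , _ , alt) = complete⇒permutationGraph G λ x y x≢y →
  to (alt x y x≢y) (from (alternate⇔narrow x y w x≢y) (narrow-of-occ≤1 x y w (≤-reflexive (U x)) (≤-reflexive (U y))))

intermediate-value-up : (g : ℕ → ℕ) (p m : ℕ) → (∀ c → c < m → g (suc c) ≤ suc (g c)) →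
  g 0 ≤ p → p ≤ g m → ∃ λ c → g c ≡ p
intermediate-value-up g p zero _ lo hi = 0 , ≤-antisym lo hi
intermediate-value-up g p (suc m) step lo hi with p ≤? g m
... | yes p≤gm = intermediate-value-up g p m (λ c c<m → step c (m<n⇒m<1+n c<m)) lo p≤gm
... | no p≰gm = suc m , ≤-antisym (≤-trans (step m ≤-refl) (≰⇒> p≰gm)) hi

intermediate-value-down : (g : ℕ → ℕ) (p m : ℕ) → (∀ c → c < m → g c ≤ suc (g (suc c))) →
  g m ≤ p → p ≤ g 0 → ∃ λ c → g c ≡ p
intermediate-value-down g p zero _ lo hi = 0 , ≤-antisym lo hi
intermediate-value-down g p (suc m) step lo hi with g m ≤? p
... | yes gm≤p = intermediate-value-down g p m (λ c c<m → step c (m<n⇒m<1+n c<m)) gm≤p hi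
... | no gm≰p = suc m , ≤-antisym lo (s≤s⁻¹ (≤-trans (≰⇒> gm≰p) (step m ≤-refl)))

module _ {n : ℕ} (c : Fin n → Bool) where

  open ClassSum c

  allOne : {b : Bool} (f : Fin n → ℕ) → (∀ x y → c x ≡ b → c y ≡ b → f x ≤ suc (f y)) →
    classSum b f ≡ classSize b → ∀ x → c x ≡ b → f x ≡ 1
  allOne f close total x cx with f x in fx
  ... | 1 = refl
  ... | 0 = ⊥-elim (<-irrefl total (classSum-< (λ y cy → subst (λ v → f y ≤ suc v) fx (close y x cy cx)) x cx
                                                (subst (_< 1) (sym fx) z<s)))
  ... | suc (suc _) = ⊥-elim (<-irrefl (sym total) (classSum-<
          (λ y cy → s≤s⁻¹ (≤-trans (s≤s (s≤s z≤n)) (subst (_≤ suc (f y)) fx (close x y cx cy)))) x cx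
          (subst (1 <_) (sym fx) (s≤s (s≤s z≤n)))))

module TwoUniform {n : ℕ} (G : Graph n) (c : Fin n → Bool) (cb : ComplementColouring G c)
  (w : Word n) (U : Uniform 2 w) (rep : Represents w G) where

  open ClassSum c

  p : ℕ
  p = classSize true

  length≡n+n : length w ≡ n + n
  length≡n+n = trans (sym (sum-occ w)) (trans (sum-cong-≗ U) (trans (sum-const {n} 2) (trans (*-comm n 2) (cong (n +_) (+-identityʳ n)))))

  F : ℕ → ℕ
  F t = classSum true (λ a → occTake a t w)

  F-mono : ∀ t → F t ≤ F (suc t)
  F-mono t = classSum-mono (λ a _ → occTake-mono a w (n≤1+n t))

  F-step : ∀ t → F (suc t) ≤ suc (F t)
  F-step t = begin
    F (suc t)
      ≡⟨ classSum-cong (λ a _ → trans (cong (λ s → occTake a s w) (+-comm 1 t)) (occTake-+ a t 1 w)) ⟩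
    classSum true (λ a → occTake a t w + nextOcc a)
      ≡⟨ classSum-+ _ nextOcc ⟩
    F t + classSum true nextOcc
      ≤⟨ +-monoʳ-≤ (F t) (≤-trans (classSum≤sum nextOcc) (≤-reflexive (sum-occ (take 1 (drop t w))))) ⟩
    F t + length (take 1 (drop t w))
      ≤⟨ +-monoʳ-≤ (F t) (subst (_≤ 1) (sym (length-take 1 (drop t w))) (m⊓n≤m 1 _)) ⟩
    F t + 1
      ≡⟨ +-comm (F t) 1 ⟩
    suc (F t) ∎
    where
    open ≤-Reasoning
    nextOcc : Fin n → ℕ
    nextOcc a = occTake a 1 (drop t w)

  F0 : F 0 ≡ 0
  F0 = classSum-const 0

  F-end : F (n + n) ≡ p + p
  F-end = trans (classSum-cong (λ a _ → trans (occTake-all a w (≤-reflexive length≡n+n)) (U a)))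
                (trans (classSum-const 2) (cong (p +_) (+-identityʳ p)))

  g : ℕ → ℕ
  g c = classSum true (λ a → occTake a n (rotate c w))

  g+F : ∀ c → c ≤ n → g c + F c ≡ F (c + n)
  g+F c c≤n = trans (sym (classSum-+ _ _)) (classSum-cong (λ a _ → occTake-rotate-low a w c n n≤drop))
    where
    n≤drop : n ≤ length (drop c w)
    n≤drop = subst (n ≤_) (sym (trans (length-drop c w) (cong (_∸ c) length≡n+n)))
      (subst (_≤ n + n ∸ c) (m+n∸n≡m n n) (∸-monoʳ-≤ (n + n) c≤n))

  g-ends : g 0 + g n ≡ p + p
  g-ends = +-cancelʳ-≡ (F n) _ _ (begin
    g 0 + g n + F n    ≡⟨ +-assoc (g 0) (g n) (F n) ⟩
    g 0 + (g n + F n)  ≡⟨ cong (g 0 +_) (trans (g+F n ≤-refl) F-end) ⟩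
    g 0 + (p + p)      ≡⟨ +-comm (g 0) _ ⟩
    p + p + g 0        ≡⟨ cong (p + p +_) (trans (sym (+-identityʳ (g 0))) (trans (cong (g 0 +_) (sym F0)) (g+F 0 z≤n))) ⟩
    p + p + F n        ∎)
    where open ≡-Reasoning

  g-up : ∀ c → c < n → g (suc c) ≤ suc (g c)
  g-up c c<n = +-cancelʳ-≤ (F (suc c)) _ _ (begin
    g (suc c) + F (suc c)  ≡⟨ g+F (suc c) c<n ⟩
    F (suc (c + n))        ≤⟨ F-step (c + n) ⟩
    suc (F (c + n))        ≡⟨ cong suc (g+F c (<⇒≤ c<n)) ⟨
    suc (g c + F c)        ≤⟨ s≤s (+-monoʳ-≤ (g c) (F-mono c)) ⟩
    suc (g c) + F (suc c)  ∎)
    where open ≤-Reasoning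

  g-down : ∀ c → c < n → g c ≤ suc (g (suc c))
  g-down c c<n = +-cancelʳ-≤ (F c) _ _ (begin
    g c + F c                  ≡⟨ g+F c (<⇒≤ c<n) ⟩
    F (c + n)                  ≤⟨ F-mono (c + n) ⟩
    F (suc (c + n))            ≡⟨ g+F (suc c) c<n ⟨
    g (suc c) + F (suc c)      ≤⟨ +-monoʳ-≤ (g (suc c)) (F-step c) ⟩
    g (suc c) + suc (F c)      ≡⟨ +-suc (g (suc c)) (F c) ⟩
    suc (g (suc c)) + F c      ∎)
    where open ≤-Reasoning

  -- g 0 + g n = 2p and g moves by at most one per step, so g takes the value p.
  balancedCut : ∃ λ c → g c ≡ p
  balancedCut with g 0 ≤? p
  ... | yes g0≤p = intermediate-value-up g p n g-up g0≤p
         (+-cancelˡ-≤ p p (g n) (subst (_≤ p + g n) g-ends (+-monoˡ-≤ (g n) g0≤p)))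
  ... | no g0≰p = intermediate-value-down g p n g-down
         (<⇒≤ (+-cancelˡ-< p (g n) p (subst (p + g n <_) g-ends (+-monoˡ-< (g n) (≰⇒> g0≰p))))) (<⇒≤ (≰⇒> g0≰p))

  w′ : Word n
  w′ = rotate (proj₁ balancedCut) w

  rep′ : Represents w′ G
  rep′ = represents-rotate {G = G} w U (proj₁ balancedCut) rep

  length-w′ : length w′ ≡ n + n
  length-w′ = trans (sym (sum-occ w′)) (trans (sum-cong-≗ (λ x → occ-rotate x (proj₁ balancedCut) w)) (trans (sum-occ w) length≡n+n))

  firstHalf-total : ∀ b → classSum b (λ x → occTake x n w′) ≡ classSize b
  firstHalf-total true = proj₂ balancedCut
  firstHalf-total false = +-cancelˡ-≡ p _ _ (begin
    p + firstHalf false                          ≡⟨ cong (_+ firstHalf false) (proj₂ balancedCut) ⟨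
    firstHalf true + firstHalf false             ≡⟨ classSum-split _ ⟩
    sum (λ x → occTake x n w′)                   ≡⟨ sum-occ (take n w′) ⟩
    length (take n w′)                           ≡⟨ length-take n w′ ⟩
    n ⊓ length w′                                ≡⟨ cong (n ⊓_) length-w′ ⟩
    n ⊓ (n + n)                                  ≡⟨ m≤n⇒m⊓n≡m (m≤m+n n n) ⟩
    n                                            ≡⟨ trans (sym (*-identityʳ n)) (sym (sum-const {n} 1)) ⟩
    sum {n} (λ _ → 1)                            ≡⟨ classSum-split (λ _ → 1) ⟨
    p + classSize false                          ∎)
    where
    open ≡-Reasoning
    firstHalf : Bool → ℕ
    firstHalf b = classSum b (λ x → occTake x n w′)

  firstHalf-once : ∀ x → occ x (take n w′) ≡ 1
  firstHalf-once x = allOne c (λ y → occTake y n w′)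
    (λ y z cy cz → sameColour⇒occTake≤suc {G = G} rep′ cb (trans cy (sym cz)) n) (firstHalf-total (c x)) x refl

  secondHalf-once : ∀ x → occ x (drop n w′) ≡ 1
  secondHalf-once x = +-cancelˡ-≡ 1 _ _ (begin
    1 + occ x (drop n w′)                  ≡⟨ cong (_+ occ x (drop n w′)) (firstHalf-once x) ⟨
    occ x (take n w′) + occ x (drop n w′)  ≡⟨ occ-take+drop x n w′ ⟩
    occ x w′                               ≡⟨ uniform-rotate (proj₁ balancedCut) U x ⟩
    2                                      ∎)
    where open ≡-Reasoning

  permutationGraph : PermutationGraph G
  permutationGraph = TwoPermutations.permutationGraph (take n w′) (drop n w′) firstHalf-once secondHalf-once G
    (subst (λ u → Represents u G) (sym (take++drop≡id n w′)) rep′)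

twoRepresentable⇒permutationGraph : (G : Graph n) → CoBipartite G → KRepresentable 2 G → PermutationGraph G
twoRepresentable⇒permutationGraph G (c , cb) (w , U , rep) = TwoUniform.permutationGraph G c cb w U rep

-- Uniform representations

module _ {P : Pred (Fin n) 0ℓ} (P? : Decidable P) where

  occ-filter-accept : {x : Fin n} → P x → (l : Word n) → occ x (filter P? l) ≡ occ x l
  occ-filter-accept px [] = refl
  occ-filter-accept {x} px (z ∷ l) with P? z
  ... | yes _ = trans (occ-∷ x z _) (trans (cong (indicator z x +_) (occ-filter-accept px l)) (sym (occ-∷ x z l)))
  ... | no ¬pz = trans (occ-filter-accept px l) (sym (occ-there l (λ z≡x → ¬pz (subst P (sym z≡x) px))))

  occ-filter-reject : {x : Fin n} → ¬ P x → (l : Word n) → occ x (filter P? l) ≡ 0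
  occ-filter-reject ¬px [] = refl
  occ-filter-reject {x} ¬px (z ∷ l) with P? z
  ... | yes pz = trans (occ-there _ (λ z≡x → ¬px (subst P z≡x pz))) (occ-filter-reject ¬px l)
  ... | no _ = occ-filter-reject ¬px l

filter-comm : {A : Set} {P Q : Pred A 0ℓ} (P? : Decidable P) (Q? : Decidable Q) (l : List A) →
  filter P? (filter Q? l) ≡ filter Q? (filter P? l)
filter-comm P? Q? [] = refl
filter-comm P? Q? (z ∷ l) with does (P? z) in pz | does (Q? z) in qz
... | true | true rewrite pz | qz = cong (z ∷_) (filter-comm P? Q? l)
... | true | false rewrite qz = filter-comm P? Q? l
... | false | true rewrite pz = filter-comm P? Q? l
... | false | false = filter-comm P? Q? l

restrict-filter : {P : Pred (Fin n) 0ℓ} (P? : Decidable P) {x y : Fin n} → P x → P y → (l : Word n) →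
  restrict x y (filter P? l) ≡ restrict x y l
restrict-filter {P = P} P? {x} {y} px py l = trans (filter-comm _ P? l) (filter-all P? (allP (restrict-letters x y l)))
  where
  allP : ∀ {r} → All (λ z → z ≡ x ⊎ z ≡ y) r → All P r
  allP [] = []
  allP (inj₁ refl ∷ rest) = px ∷ allP rest
  allP (inj₂ refl ∷ rest) = py ∷ allP rest

lead-restrict : {x y : Fin n} (l l′ : Word n) → x ≢ y → restrict x y l ≡ restrict x y l′ → Lead x y l → Lead x y l′
lead-restrict {x = x} {y} l l′ x≢y same L =
  from (lead⇔altFrom x y l′ x≢y) (subst (AltFrom x y) same (to (lead⇔altFrom x y l x≢y) L))

lead-of-occ : {x y : Fin n} (v : Word n) → occ x v ≤ 1 → occ y v ≡ 0 → Lead x y v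
lead-of-occ {x = x} {y} v x≤1 y≡0 t rewrite occTake-absent y v y≡0 t = z≤n , ≤-trans (occTake≤occ x t v) x≤1

lead⇒occ≤ : {x y : Fin n} {v : Word n} → Lead x y v → occ y v ≤ occ x v
lead⇒occ≤ {x = x} {y} {v} L = subst₂ _≤_ (occTake-all y v ≤-refl) (occTake-all x v ≤-refl) (proj₁ (L (length v)))

¬lead-both : {x y : Fin n} (v : Word n) → x ≢ y → 0 < occ x v → Lead x y v → Lead y x v → ⊥
¬lead-both {x = x} {y} v x≢y x∈v L L′ =
  <-irrefl (sym (equalPrefixOcc⇒absent x y v x≢y λ t → ≤-antisym (proj₁ (L′ t)) (proj₁ (L t)))) x∈v

occ-deduplicate≤1 : (x : Fin n) (w : Word n) → occ x (deduplicate _≟_ w) ≤ 1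
occ-deduplicate≤1 x [] = z≤n
occ-deduplicate≤1 x (z ∷ w) with z ≟ x
... | yes refl = s≤s (≤-reflexive (occ-filter-reject (¬? ∘ (z ≟_)) (λ ¬z≡z → ¬z≡z refl) (deduplicate _≟_ w)))
... | no z≢x = subst (_≤ 1) (sym (occ-filter-accept (¬? ∘ (z ≟_)) z≢x (deduplicate _≟_ w))) (occ-deduplicate≤1 x w)

occ-deduplicate : {x : Fin n} {w : Word n} → x ∈ w → occ x (deduplicate _≟_ w) ≡ 1
occ-deduplicate {x = x} {w} x∈w = ≤-antisym (occ-deduplicate≤1 x w) (∈⇒occ>0 (∈-deduplicate⁺ _≟_ x∈w))

lead-deduplicate : {x y : Fin n} (w : Word n) → x ≢ y → x ∈ w → Lead x y w → Lead x y (deduplicate _≟_ w)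
lead-deduplicate {x = x} {y} (z ∷ w) x≢y x∈ L with z ≟ x | z ≟ y
... | yes refl | _ = from (lead-∷-first rest x≢y)
  (lead-of-occ rest (≤-trans (≤-reflexive (occ-filter-accept (¬? ∘ (x ≟_)) x≢y (deduplicate _≟_ w))) (occ-deduplicate≤1 y w))
                    (occ-filter-reject (¬? ∘ (x ≟_)) (λ ¬x≡x → ¬x≡x refl) (deduplicate _≟_ w)))
  where rest = filter (¬? ∘ (x ≟_)) (deduplicate _≟_ w)
... | no _ | yes refl = ⊥-elim (¬lead-∷-second w x≢y L)
... | no z≢x | no z≢y with x∈
...   | here x≡z = ⊥-elim (z≢x (sym x≡z))
...   | there x∈w = from (lead-∷-other _ z≢x z≢y)
  (lead-restrict (deduplicate _≟_ w) _ x≢y (sym (restrict-filter (¬? ∘ (z ≟_)) z≢x z≢y (deduplicate _≟_ w)))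
    (lead-deduplicate w x≢y x∈w (to (lead-∷-other w z≢x z≢y) L)))

leadsBy≤1-+ : (k a b : ℕ) → LeadsBy≤1 (k + a) (k + b) ⇔ LeadsBy≤1 a b
leadsBy≤1-+ k a b = mk⇔
  (λ (lo , hi) → +-cancelˡ-≤ k _ _ lo , +-cancelˡ-≤ k _ _ (subst (k + a ≤_) (sym (+-suc k b)) hi))
  (λ (lo , hi) → +-monoʳ-≤ k lo , subst (k + a ≤_) (+-suc k b) (+-monoʳ-≤ k hi))

leadsBy≤1-+-suc : (k a b : ℕ) → LeadsBy≤1 (suc k + a) (k + b) ⇔ LeadsBy≤1 b a
leadsBy≤1-+-suc k a b = mk⇔
  (λ (lo , hi) → +-cancelˡ-≤ k _ _ (s≤s⁻¹ hi) , +-cancelˡ-≤ k _ _ (subst (k + b ≤_) (sym (+-suc k a)) lo))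
  (λ (a≤b , b≤sa) → subst (k + b ≤_) (+-suc k a) (+-monoʳ-≤ k b≤sa) , s≤s (+-monoʳ-≤ k a≤b))

module _ {x y : Fin n} (u w : Word n) where

  lead-++ˡ : Lead x y (u ++ w) → Lead x y u
  lead-++ˡ L t with t ≤? length u
  ... | yes t≤u = subst₂ LeadsBy≤1 (occTake-++ˡ x u w t≤u) (occTake-++ˡ y u w t≤u) (L t)
  ... | no t≰u = subst₂ LeadsBy≤1 (atEnd x) (atEnd y) (L (length u))
    where
    atEnd : ∀ z → occTake z (length u) (u ++ w) ≡ occTake z t u
    atEnd z = trans (occTake-++ˡ z u w ≤-refl) (trans (occTake-all z u ≤-refl) (sym (occTake-all z u (<⇒≤ (≰⇒> t≰u)))))

  lead-++ : Lead x y (u ++ w) ⇔ (Lead x y u × ∀ s → LeadsBy≤1 (occ x u + occTake x s w) (occ y u + occTake y s w))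
  lead-++ = mk⇔
    (λ L → lead-++ˡ L , λ s → subst₂ LeadsBy≤1 (occTake-++ʳ x u w s) (occTake-++ʳ y u w s) (L (length u + s)))
    (λ (Lu , later) → splitAt (length u) _
      (λ t t≤u → subst₂ LeadsBy≤1 (sym (occTake-++ˡ x u w t≤u)) (sym (occTake-++ˡ y u w t≤u)) (Lu t))
      (λ s → subst₂ LeadsBy≤1 (sym (occTake-++ʳ x u w s)) (sym (occTake-++ʳ y u w s)) (later s)))

  lead-++-balanced : occ x u ≡ occ y u → Lead x y (u ++ w) ⇔ (Lead x y u × Lead x y w)
  lead-++-balanced e = ⇔-trans lead-++ (mk⇔
    (λ (Lu , later) → Lu , λ s → to (leadsBy≤1-+ (occ y u) _ _) (subst (λ k → LeadsBy≤1 (k + _) _) e (later s)))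
    (λ (Lu , Lw) → Lu , λ s → subst (λ k → LeadsBy≤1 (k + _) _) (sym e) (from (leadsBy≤1-+ (occ y u) _ _) (Lw s))))

  lead-++-ahead : occ x u ≡ suc (occ y u) → Lead x y (u ++ w) ⇔ (Lead x y u × Lead y x w)
  lead-++-ahead e = ⇔-trans lead-++ (mk⇔
    (λ (Lu , later) → Lu , λ s → to (leadsBy≤1-+-suc (occ y u) _ _) (subst (λ k → LeadsBy≤1 (k + _) _) e (later s)))
    (λ (Lu , Lw) → Lu , λ s → subst (λ k → LeadsBy≤1 (k + _) _) (sym e) (from (leadsBy≤1-+-suc (occ y u) _ _) (Lw s))))

⊎-swap⇔ : {A B : Set} → (A ⊎ B) ⇔ (B ⊎ A)
⊎-swap⇔ = mk⇔ swap swap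

×-known⇔ : {A B : Set} → A → (A × B) ⇔ B
×-known⇔ a = mk⇔ proj₂ (a ,_)

-- Prepending the deficient letters in the order of their first occurrence preserves the represented graph.
module Padding {n : ℕ} (G : Graph n) (m : ℕ) (w : Word n) (rep : Represents w G) (bounded : ∀ x → occ x w ≤ m) where

  Deficient : Fin n → Set
  Deficient x = occ x w < m

  u : Word n
  u = filter (λ x → occ x w <? m) (deduplicate _≟_ w)

  w′ : Word n
  w′ = u ++ w

  occ-u-deficient : ∀ {x} → Deficient x → occ x u ≡ 1
  occ-u-deficient {x} dx = trans (occ-filter-accept (λ x → occ x w <? m) dx (deduplicate _≟_ w)) (occ-deduplicate (proj₁ rep x))

  occ-u-full : ∀ {x} → ¬ Deficient x → occ x u ≡ 0
  occ-u-full ¬dx = occ-filter-reject (λ x → occ x w <? m) ¬dx (deduplicate _≟_ w)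

  occ-w′ : ∀ x → occ x w′ ≡ (occ x w + 1) ⊓ m
  occ-w′ x with occ x w <? m
  ... | yes dx = trans (occ-++ x u w) (trans (cong (_+ occ x w) (occ-u-deficient dx))
                   (trans (+-comm 1 (occ x w)) (sym (m≤n⇒m⊓n≡m (subst (_≤ m) (+-comm 1 (occ x w)) dx)))))
  ... | no ¬dx = trans (occ-++ x u w) (trans (cong (_+ occ x w) (occ-u-full ¬dx))
                   (trans full (sym (m≥n⇒m⊓n≡n (≤-trans (≤-reflexive (sym full)) (m≤m+n _ 1))))))
    where
    full : occ x w ≡ m
    full = ≤-antisym (bounded x) (≮⇒≥ ¬dx)

  PairPreserved : Fin n → Fin n → Set
  PairPreserved x y = (Lead x y w′ ⊎ Lead y x w′) ⇔ (Lead x y w ⊎ Lead y x w)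

  pairPreserved-sym : ∀ {x y} → PairPreserved x y → PairPreserved y x
  pairPreserved-sym same = ⇔-trans ⊎-swap⇔ (⇔-trans same ⊎-swap⇔)

  bothFull : ∀ {x y} → ¬ Deficient x → ¬ Deficient y → PairPreserved x y
  bothFull {x} {y} ¬dx ¬dy = unchanged x y ¬dx ¬dy ⊎-⇔ unchanged y x ¬dy ¬dx
    where
    unchanged : ∀ x y → ¬ Deficient x → ¬ Deficient y → Lead x y w′ ⇔ Lead x y w
    unchanged x y ¬dx ¬dy = ⇔-trans (lead-++-balanced u w (trans (occ-u-full ¬dx) (sym (occ-u-full ¬dy))))
      (×-known⇔ (lead-of-occ u (≤-trans (≤-reflexive (occ-u-full ¬dx)) z≤n) (occ-u-full ¬dy)))

  oneDeficient : ∀ {x y} → Deficient x → ¬ Deficient y → PairPreserved x y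
  oneDeficient {x} {y} dx ¬dy = mk⇔
    (λ { (inj₁ L) → inj₂ (to shifted L) ; (inj₂ L) → ⊥-elim (¬leadᵤ (lead-++ˡ u w L)) })
    (λ { (inj₁ L) → ⊥-elim (<⇒≱ (<-≤-trans dx (≮⇒≥ ¬dy)) (lead⇒occ≤ L)) ; (inj₂ L) → inj₁ (from shifted L) })
    where
    shifted : Lead x y w′ ⇔ Lead y x w
    shifted = ⇔-trans (lead-++-ahead u w (trans (occ-u-deficient dx) (cong suc (sym (occ-u-full ¬dy)))))
      (×-known⇔ (lead-of-occ u (≤-reflexive (occ-u-deficient dx)) (occ-u-full ¬dy)))
    ¬leadᵤ : ¬ Lead y x u
    ¬leadᵤ L = <⇒≱ (subst₂ _<_ (sym (occ-u-full ¬dy)) (sym (occ-u-deficient dx)) z<s) (lead⇒occ≤ L)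

  firstOccurrenceOrder : ∀ {x y} → Deficient x → Deficient y → x ≢ y → Lead x y w → Lead x y u
  firstOccurrenceOrder {x} dx dy x≢y L = lead-restrict (deduplicate _≟_ w) u x≢y
    (sym (restrict-filter (λ x → occ x w <? m) dx dy (deduplicate _≟_ w))) (lead-deduplicate w x≢y (proj₁ rep x) L)

  bothDeficient : ∀ {x y} → Deficient x → Deficient y → x ≢ y → Lead x y u → PairPreserved x y
  bothDeficient {x} {y} dx dy x≢y Lu = mk⇔
    (λ { (inj₁ L) → inj₁ (to same L) ; (inj₂ L) → ⊥-elim (¬leadᵤ (lead-++ˡ u w L)) })
    (λ { (inj₁ L) → inj₁ (from same L) ; (inj₂ L) → ⊥-elim (¬leadᵤ (firstOccurrenceOrder dy dx (x≢y ∘ sym) L)) })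
    where
    same : Lead x y w′ ⇔ Lead x y w
    same = ⇔-trans (lead-++-balanced u w (trans (occ-u-deficient dx) (sym (occ-u-deficient dy)))) (×-known⇔ Lu)
    ¬leadᵤ : ¬ Lead y x u
    ¬leadᵤ = ¬lead-both u x≢y (subst (0 <_) (sym (occ-u-deficient dx)) z<s) Lu

  pairPreserved : ∀ x y → x ≢ y → PairPreserved x y
  pairPreserved x y x≢y with occ x w <? m | occ y w <? m
  ... | no ¬dx | no ¬dy = bothFull ¬dx ¬dy
  ... | yes dx | no ¬dy = oneDeficient dx ¬dy
  ... | no ¬dx | yes dy = pairPreserved-sym (oneDeficient dy ¬dx)
  ... | yes dx | yes dy with narrow⇒lead (narrow-of-occ≤1 x y u (≤-reflexive (occ-u-deficient dx)) (≤-reflexive (occ-u-deficient dy)))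
  ...   | inj₁ Lu = bothDeficient dx dy x≢y Lu
  ...   | inj₂ Lu = pairPreserved-sym (bothDeficient dy dx (x≢y ∘ sym) Lu)

  rep′ : Represents w′ G
  rep′ = represents-transfer {G = G} member′ (λ x y x≢y →
    ⇔-trans (alternate⇔lead x y w′ x≢y) (⇔-trans (pairPreserved x y x≢y) (⇔-sym (alternate⇔lead x y w x≢y))))
    rep
    where
    member′ : ∀ x → x ∈ w′
    member′ x = occ>0⇒∈ w′ (subst (0 <_) (sym (occ-++ x u w)) (≤-trans (∈⇒occ>0 (proj₁ rep x)) (m≤n+m _ _)))

pad : (G : Graph n) (m i : ℕ) (w : Word n) → Represents w G → (∀ x → occ x w ≤ m) →
  Σ (Word n) λ w′ → Represents w′ G × (∀ x → occ x w′ ≡ (occ x w + i) ⊓ m)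
pad G m zero w rep bounded = w , rep , λ x → sym (trans (cong (_⊓ m) (+-identityʳ _)) (m≤n⇒m⊓n≡m (bounded x)))
pad G m (suc i) w rep bounded =
  let module P = Padding G m w rep bounded
      (w″ , rep″ , occ″) = pad G m i P.w′ P.rep′ (λ x → subst (_≤ m) (sym (P.occ-w′ x)) (m⊓n≤n _ _)) in
  w″ , rep″ , λ x → trans (occ″ x) (trans (cong (λ k → (k + i) ⊓ m) (P.occ-w′ x)) (min-shift (occ x w)))
  where
  min-shift : ∀ a → ((a + 1) ⊓ m + i) ⊓ m ≡ (a + suc i) ⊓ m
  min-shift a = begin
    ((a + 1) ⊓ m + i) ⊓ m        ≡⟨ cong (_⊓ m) (+-distribʳ-⊓ i (a + 1) m) ⟩
    ((a + 1 + i) ⊓ (m + i)) ⊓ m  ≡⟨ ⊓-assoc (a + 1 + i) (m + i) m ⟩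
    (a + 1 + i) ⊓ ((m + i) ⊓ m)  ≡⟨ cong ((a + 1 + i) ⊓_) (m≥n⇒m⊓n≡n (m≤m+n m i)) ⟩
    (a + 1 + i) ⊓ m              ≡⟨ cong (_⊓ m) (trans (+-assoc a 1 i) refl) ⟩
    (a + suc i) ⊓ m              ∎
    where open ≡-Reasoning

wordRepresentable⇒uniform : (G : Graph n) → WordRepresentable G → Σ ℕ λ k → KRepresentable k G
wordRepresentable⇒uniform G (w , rep) =
  let m = length w
      (w′ , rep′ , occ′) = pad G m m w rep (λ x → length-filter (λ z → T? (does (z ≟ x))) w) in
  m , w′ , (λ x → trans (occ′ x) (m≥n⇒m⊓n≡n (m≤n+m m (occ x w)))) , rep′

argmin : (g h : ℕ → ℕ) (T : ℕ) → ∃ λ c → ∀ t → t ≤ T → g c + h t ≤ g t + h c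
argmin g h zero = 0 , λ { .zero z≤n → ≤-refl }
argmin g h (suc T) with argmin g h T
... | c , min with g c + h (suc T) ≤? g (suc T) + h c
...   | yes le = c , λ t t≤ → case t≤ le
  where
  case : ∀ {t} → t ≤ suc T → g c + h (suc T) ≤ g (suc T) + h c → g c + h t ≤ g t + h c
  case {t} t≤ le with t ℕ.≟ suc T
  ... | yes refl = le
  ... | no t≢ = min t (s≤s⁻¹ (≤∧≢⇒< t≤ t≢))
...   | no gt = suc T , λ t t≤ → case t≤
  where
  open +-*-Solver
  case : ∀ {t} → t ≤ suc T → g (suc T) + h t ≤ g t + h (suc T)
  case {t} t≤ with t ℕ.≟ suc T
  ... | yes refl = ≤-refl
  ... | no t≢ = <⇒≤ (+-cancelʳ-< (g c + h c) _ _ (subst₂ _<_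
    (solve 4 (λ a b d e → d :+ b :+ (a :+ e) := a :+ b :+ (d :+ e)) refl (g (suc T)) (h t) (g c) (h c))
    (solve 4 (λ a b d e → a :+ b :+ (d :+ e) := a :+ e :+ (d :+ b)) refl (g t) (h c) (g c) (h (suc T)))
    (+-mono-≤-< (min t (s≤s⁻¹ (≤∧≢⇒< t≤ t≢))) (≰⇒> gt))))

-- Rotating at a minimiser of q · occTake a* t w − Σ_b occTake b t w makes that difference
-- nonnegative on every prefix, and then a* is never behind any vertex of the second class.
module Dominate {n : ℕ} (G : Graph n) (c : Fin n → Bool) (cb : ComplementColouring G c)
  (k : ℕ) (w : Word n) (U : Uniform k w) (rep : Represents w G) (a* : Fin n) where

  open ClassSum c

  q : ℕ
  q = classSize false

  secondClassCount : Word n → ℕ → ℕ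
  secondClassCount v t = classSum false (λ b → occTake b t v)

  scaledCount : ℕ → ℕ
  scaledCount t = q * occTake a* t w

  c₀ : ℕ
  c₀ = proj₁ (argmin scaledCount (secondClassCount w) (length w))

  minimal : ∀ t → scaledCount c₀ + secondClassCount w t ≤ scaledCount t + secondClassCount w c₀
  minimal t with t ≤? length w
  ... | yes t≤w = proj₂ (argmin scaledCount (secondClassCount w) (length w)) t t≤w
  ... | no t≰w = subst₂ (λ a b → scaledCount c₀ + a ≤ b + secondClassCount w c₀)
      (classSum-cong (λ b _ → sameEnd b)) (cong (q *_) (sameEnd a*))
      (proj₂ (argmin scaledCount (secondClassCount w) (length w)) (length w) ≤-refl)
    where
    sameEnd : ∀ x → occTake x (length w) w ≡ occTake x t w
    sameEnd x = trans (occTake-all x w ≤-refl) (sym (occTake-all x w (<⇒≤ (≰⇒> t≰w))))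

  w′ : Word n
  w′ = rotate c₀ w

  rep′ : Represents w′ G
  rep′ = represents-rotate {G = G} w U c₀ rep

  secondClass≤ : ∀ t → secondClassCount w′ t ≤ q * occTake a* t w′
  secondClass≤ t = let (τ , e , shift) = occTake-rotate w U c₀ t in
    +-cancelʳ-≤ (secondClassCount w c₀ + scaledCount c₀) _ _ (begin
      secondClassCount w′ t + (secondClassCount w c₀ + scaledCount c₀)
        ≡⟨ sym (+-assoc (secondClassCount w′ t) _ _) ⟩
      secondClassCount w′ t + secondClassCount w c₀ + scaledCount c₀
        ≡⟨ cong (_+ scaledCount c₀) (sym (classSum-+ _ _)) ⟩
      classSum false (λ b → occTake b t w′ + occTake b c₀ w) + scaledCount c₀
        ≡⟨ cong (_+ scaledCount c₀) (classSum-cong (λ b _ → shift b)) ⟩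
      classSum false (λ b → occTake b τ w + e) + scaledCount c₀
        ≡⟨ cong (_+ scaledCount c₀) (trans (classSum-+ _ _) (cong (secondClassCount w τ +_) (classSum-const e))) ⟩
      secondClassCount w τ + e * q + q * occTake a* c₀ w
        ≡⟨ solve 4 (λ s e q m → s :+ e :* q :+ q :* m := q :* m :+ s :+ e :* q) refl (secondClassCount w τ) e q (occTake a* c₀ w) ⟩
      scaledCount c₀ + secondClassCount w τ + e * q
        ≤⟨ +-monoˡ-≤ (e * q) (minimal τ) ⟩
      scaledCount τ + secondClassCount w c₀ + e * q
        ≡⟨ solve 4 (λ m s e q → q :* m :+ s :+ e :* q := q :* (m :+ e) :+ s) refl (occTake a* τ w) (secondClassCount w c₀) e q ⟩
      q * (occTake a* τ w + e) + secondClassCount w c₀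
        ≡⟨ cong (λ v → q * v + secondClassCount w c₀) (sym (shift a*)) ⟩
      q * (occTake a* t w′ + occTake a* c₀ w) + secondClassCount w c₀
        ≡⟨ solve 4 (λ a b q s → q :* (a :+ b) :+ s := q :* a :+ (s :+ q :* b)) refl (occTake a* t w′) (occTake a* c₀ w) q (secondClassCount w c₀) ⟩
      q * occTake a* t w′ + (secondClassCount w c₀ + scaledCount c₀) ∎)
    where
    open ≤-Reasoning
    open +-*-Solver

  dominates : ∀ b → c b ≡ false → ∀ t → occTake b t w′ ≤ occTake a* t w′
  dominates b cb≡f t with occTake b t w′ ≤? occTake a* t w′
  ... | yes le = le
  ... | no b>a = ⊥-elim (<⇒≱ tooMany (secondClass≤ t))
    where
    atLeast : ∀ b′ → c b′ ≡ false → occTake a* t w′ ≤ occTake b′ t w′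
    atLeast b′ cb′ = s≤s⁻¹ (≤-trans (≰⇒> b>a) (sameColour⇒occTake≤suc {G = G} rep′ cb (trans cb≡f (sym cb′)) t))
    tooMany : q * occTake a* t w′ < secondClassCount w′ t
    tooMany = subst (_< secondClassCount w′ t) (trans (classSum-const (occTake a* t w′)) (*-comm _ q))
      (classSum-< atLeast b cb≡f (≰⇒> b>a))

-- The order within a colour class

module ClassOrder {n : ℕ} (G : Graph n) (c : Fin n → Bool) (cb : ComplementColouring G c)
  (w : Word n) (rep : Represents w G) where

  open ClassSum c

  Precedes : Fin n → Fin n → Set
  Precedes x y = x ≢ y × excess y x w ≡ 0

  precedes : Fin n → Fin n → ℕ
  precedes x y = bit (¬? (x ≟ y) ×-dec (excess y x w ℕ.≟ 0))

  precedes≡1⇒ : ∀ {x y} → precedes x y ≡ 1 → Precedes x y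
  precedes≡1⇒ = bit≡1⇒ (¬? (_ ≟ _) ×-dec (_ ℕ.≟ 0))

  precedes-yes : ∀ {x y} → Precedes x y → precedes x y ≡ 1
  precedes-yes = bit-yes (¬? (_ ≟ _) ×-dec (_ ℕ.≟ 0))

  precedes≤1 : ∀ x y → precedes x y ≤ 1
  precedes≤1 x y = bit≤1 (¬? (x ≟ y) ×-dec (excess y x w ℕ.≟ 0))

  precedes-self : ∀ x → precedes x x ≡ 0
  precedes-self x with bit-cases (¬? (x ≟ x) ×-dec (excess x x w ℕ.≟ 0))
  ... | inj₁ e = e
  ... | inj₂ e = ⊥-elim (proj₁ (precedes≡1⇒ e) refl)

  precedes⇒lead : ∀ {x y} → Precedes x y → c x ≡ c y → Lead x y w
  precedes⇒lead (x≢y , e) cx≡cy t = excess≡0⇒ e t , narrow-upper (sameColour⇒narrow {G = G} rep cb x≢y cx≡cy) t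

  lead⇒precedes : ∀ {x y} → x ≢ y → Lead x y w → Precedes x y
  lead⇒precedes x≢y L = x≢y , lead⇒excess≡0 L

  precedes-asym : ∀ {x y} → Precedes x y → ¬ Precedes y x
  precedes-asym {x} {y} (x≢y , eyx) (_ , exy) = <-irrefl (sym absent) (∈⇒occ>0 (proj₁ rep x))
    where
    absent : occ x w ≡ 0
    absent = equalPrefixOcc⇒absent x y w x≢y λ t → ≤-antisym (excess≡0⇒ exy t) (excess≡0⇒ eyx t)

  precedes-trans : ∀ {x y z} → Precedes x y → Precedes y z → Precedes x z
  precedes-trans {x} {y} {z} xy@(_ , eyx) yz@(_ , ezy) =
    x≢z , excess≡0 {x = z} {x} {w} λ t → ≤-trans (excess≡0⇒ ezy t) (excess≡0⇒ eyx t)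
    where
    x≢z : x ≢ z
    x≢z refl = precedes-asym xy yz

  precedes-total : ∀ {x y} → x ≢ y → c x ≡ c y → Precedes x y ⊎ Precedes y x
  precedes-total x≢y cx≡cy with narrow⇒lead (sameColour⇒narrow {G = G} rep cb x≢y cx≡cy)
  ... | inj₁ L = inj₁ (lead⇒precedes x≢y L)
  ... | inj₂ L = inj₂ (lead⇒precedes (x≢y ∘ sym) L)

  precedes-no : ∀ {x y} → ¬ Precedes x y → precedes x y ≡ 0
  precedes-no = bit-no (¬? (_ ≟ _) ×-dec (_ ℕ.≟ 0))

  precedes-sum : ∀ {x y} → x ≢ y → c x ≡ c y → precedes x y + precedes y x ≡ 1
  precedes-sum x≢y cx≡cy with precedes-total x≢y cx≡cy
  ... | inj₁ xy = cong₂ _+_ (precedes-yes xy) (precedes-no (precedes-asym xy))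
  ... | inj₂ yx = cong₂ _+_ (precedes-no (precedes-asym yx)) (precedes-yes yx)

  precedes-mono : ∀ x {y y′} → Precedes y y′ → precedes x y ≤ precedes x y′
  precedes-mono x {y} yy′ with bit-cases (¬? (x ≟ y) ×-dec (excess y x w ℕ.≟ 0))
  ... | inj₁ e = subst (_≤ _) (sym e) z≤n
  ... | inj₂ e = ≤-reflexive (trans e (sym (precedes-yes (precedes-trans (precedes≡1⇒ e) yy′))))

  rank corank : Bool → Fin n → ℕ
  rank γ y = classSum γ (λ x → precedes x y)
  corank γ y = classSum γ (precedes y)

  rank-< : ∀ {γ y y′} → Precedes y y′ → c y ≡ γ → rank γ y < rank γ y′
  rank-< {y = y} yy′ cy = classSum-< (λ x _ → precedes-mono x yy′) y cy
    (subst₂ _<_ (sym (precedes-self y)) (sym (precedes-yes yy′)) z<s)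

  rank<classSize : ∀ {γ y} → c y ≡ γ → rank γ y < classSize γ
  rank<classSize {y = y} cy = classSum-< (λ x _ → precedes≤1 x y) y cy (subst (_< 1) (sym (precedes-self y)) z<s)

  rank+corank : ∀ {γ y} → c y ≡ γ → rank γ y + corank γ y + 1 ≡ classSize γ
  rank+corank {γ} {y} cy = begin
    rank γ y + corank γ y + 1                                  ≡⟨ cong₂ _+_ (sym (classSum-+ _ _)) (sym (classSum-indicator y cy)) ⟩
    classSum γ (λ x → precedes x y + precedes y x) + classSum γ (indicator y) ≡⟨ sym (classSum-+ _ _) ⟩
    classSum γ (λ x → precedes x y + precedes y x + indicator y x) ≡⟨ classSum-cong pointwise ⟩
    classSize γ                                                ∎
    where
    open ≡-Reasoning
    pointwise : ∀ x → c x ≡ γ → precedes x y + precedes y x + indicator y x ≡ 1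
    pointwise x cx = byCases (y ≟ x)
      where
      byCases : Dec (y ≡ x) → precedes x y + precedes y x + indicator y x ≡ 1
      byCases (yes refl) = cong₂ _+_ (cong₂ _+_ (precedes-self y) (precedes-self y)) (indicator-self y)
      byCases (no y≢x) = trans (cong (precedes x y + precedes y x +_) (indicator-other y≢x))
        (trans (+-identityʳ _) (precedes-sum (y≢x ∘ sym) (trans cx (sym cy))))

  rank-injective : ∀ {γ x y} → c x ≡ γ → c y ≡ γ → rank γ x ≡ rank γ y → x ≡ y
  rank-injective {x = x} {y} cx cy e with x ≟ y
  ... | yes x≡y = x≡y
  ... | no x≢y with precedes-total x≢y (trans cx (sym cy))
  ...   | inj₁ xy = ⊥-elim (<-irrefl e (rank-< xy cx))
  ...   | inj₂ yx = ⊥-elim (<-irrefl (sym e) (rank-< yx cy))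

  Window : ℕ → ℕ → ℕ → Set
  Window m m′ k = m ≤ m′ + k × m′ + k ≤ suc m

  window-0 : ∀ {m m′} → m ≤ m′ → m′ ≤ suc m → Window m m′ 0
  window-0 {m} {m′} m≤m′ m′≤sm = subst (m ≤_) (sym (+-identityʳ m′)) m≤m′ , subst (_≤ suc m) (sym (+-identityʳ m′)) m′≤sm

  window-1 : ∀ {m m′} → m′ ≤ m → m ≤ suc m′ → Window m m′ 1
  window-1 {m} {m′} m′≤m m≤sm′ = subst (m ≤_) (+-comm 1 m′) m≤sm′ , subst (_≤ suc m) (+-comm 1 m′) (s≤s m′≤m)

  excess-windowʳ : ∀ {y y′} → c y ≡ c y′ → ∀ x → Window (excess x y w) (excess x y′ w) (precedes y′ y)
  excess-windowʳ {y} {y′} cy≡cy′ x = byCases (y′ ≟ y)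
    where
    byCases : Dec (y′ ≡ y) → Window (excess x y w) (excess x y′ w) (precedes y′ y)
    byCases (yes refl) = subst (Window _ _) (sym (precedes-self y′)) (window-0 ≤-refl (n≤1+n _))
    byCases (no y′≢y) with precedes-total y′≢y (sym cy≡cy′)
    ... | inj₁ y′y = let L = precedes⇒lead y′y (sym cy≡cy′) in
      subst (Window _ _) (sym (precedes-yes y′y)) (window-1 (excess-antiʳ (proj₁ ∘ L)) (excess-lipʳ (proj₂ ∘ L)))
    ... | inj₂ yy′ = let L = precedes⇒lead yy′ cy≡cy′ in
      subst (Window _ _) (sym (precedes-no (precedes-asym yy′))) (window-0 (excess-antiʳ (proj₁ ∘ L)) (excess-lipʳ (proj₂ ∘ L)))

  excess-windowˡ : ∀ {y y′} → c y ≡ c y′ → ∀ x → Window (excess y x w) (excess y′ x w) (precedes y y′)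
  excess-windowˡ {y} {y′} cy≡cy′ x = byCases (y′ ≟ y)
    where
    byCases : Dec (y′ ≡ y) → Window (excess y x w) (excess y′ x w) (precedes y y′)
    byCases (yes refl) = subst (Window _ _) (sym (precedes-self y′)) (window-0 ≤-refl (n≤1+n _))
    byCases (no y′≢y) with precedes-total y′≢y (sym cy≡cy′)
    ... | inj₂ yy′ = let L = precedes⇒lead yy′ cy≡cy′ in
      subst (Window _ _) (sym (precedes-yes yy′)) (window-1 (excess-monoˡ (proj₁ ∘ L)) (excess-lipˡ (proj₂ ∘ L)))
    ... | inj₁ y′y = let L = precedes⇒lead y′y (sym cy≡cy′) in
      subst (Window _ _) (sym (precedes-no (precedes-asym y′y))) (window-0 (excess-monoˡ (proj₁ ∘ L)) (excess-lipˡ (proj₂ ∘ L)))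

  outExcess inExcess : Bool → Fin n → ℕ
  outExcess γ x = classSum γ (λ y → excess x y w)
  inExcess γ x = classSum γ (λ y → excess y x w)

  excess-floorʳ : ∀ {γ y} → c y ≡ γ → ∀ x →
    excess x y w * classSize γ ≤ outExcess γ x + rank γ y × outExcess γ x + rank γ y < suc (excess x y w) * classSize γ
  excess-floorʳ {γ} {y} cy x =
    subst (λ s → excess x y w * classSize γ ≤ s × s < suc (excess x y w) * classSize γ)
      (classSum-+ (λ y′ → excess x y′ w) (λ y′ → precedes y′ y))
    (classSum-between (λ y′ → excess x y′ w + precedes y′ y) (excess x y w)
      (λ y′ cy′ → excess-windowʳ (trans cy (sym cy′)) x) y cy (trans (cong (excess x y w +_) (precedes-self y)) (+-identityʳ _)))

  excess-floorˡ : ∀ {γ y} → c y ≡ γ → ∀ x →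
    excess y x w * classSize γ ≤ inExcess γ x + corank γ y × inExcess γ x + corank γ y < suc (excess y x w) * classSize γ
  excess-floorˡ {γ} {y} cy x =
    subst (λ s → excess y x w * classSize γ ≤ s × s < suc (excess y x w) * classSize γ)
      (classSum-+ (λ y′ → excess y′ x w) (precedes y))
    (classSum-between (λ y′ → excess y′ x w + precedes y y′) (excess y x w)
      (λ y′ cy′ → excess-windowˡ (trans cy (sym cy′)) x) y cy (trans (cong (excess y x w +_) (precedes-self y)) (+-identityʳ _)))

  module _ {γ : Bool} {a a′ : Fin n} (aa′ : Precedes a a′) (ca≡ca′ : c a ≡ c a′) where

    private
      L = precedes⇒lead aa′ ca≡ca′

    outExcess-anti : outExcess γ a′ ≤ outExcess γ a
    outExcess-anti = classSum-mono (λ y _ → excess-monoˡ (proj₁ ∘ L))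

    outExcess-lip : outExcess γ a ≤ outExcess γ a′ + classSize γ
    outExcess-lip = subst (outExcess γ a ≤_) (classSum-+ (λ y → excess a′ y w) (λ _ → 1))
      (classSum-mono (λ y _ → subst (excess a y w ≤_) (+-comm 1 _) (excess-lipˡ (proj₂ ∘ L))))

    inExcess-mono : inExcess γ a ≤ inExcess γ a′
    inExcess-mono = classSum-mono (λ y _ → excess-antiʳ (proj₁ ∘ L))

    inExcess-lip : inExcess γ a′ ≤ inExcess γ a + classSize γ
    inExcess-lip = subst (inExcess γ a′ ≤_) (classSum-+ (λ y → excess y a w) (λ _ → 1))
      (classSum-mono (λ y _ → subst (excess y a′ w ≤_) (+-comm 1 _) (excess-lipʳ (proj₂ ∘ L))))

  outExcess-spread : ∀ {γ a a′} → c a ≡ c a′ → outExcess γ a′ ≤ outExcess γ a + classSize γ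
  outExcess-spread {a = a} {a′} ca≡ca′ with a ≟ a′
  ... | yes refl = m≤m+n _ _
  ... | no a≢a′ with precedes-total a≢a′ ca≡ca′
  ...   | inj₁ aa′ = ≤-trans (outExcess-anti aa′ ca≡ca′) (m≤m+n _ _)
  ...   | inj₂ a′a = outExcess-lip a′a (sym ca≡ca′)

  inExcess-spread : ∀ {γ a a′} → c a ≡ c a′ → inExcess γ a ≤ inExcess γ a′ + classSize γ
  inExcess-spread {a = a} {a′} ca≡ca′ with a ≟ a′
  ... | yes refl = m≤m+n _ _
  ... | no a≢a′ with precedes-total a≢a′ ca≡ca′
  ...   | inj₁ aa′ = ≤-trans (inExcess-mono aa′ ca≡ca′) (m≤m+n _ _)
  ...   | inj₂ a′a = inExcess-lip a′a (sym ca≡ca′)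

  adjacent⇔excess≤1 : ∀ x y → x ≢ y → Adjacent G x y ⇔ excess x y w + excess y x w ≤ 1
  adjacent⇔excess≤1 x y x≢y =
    ⇔-trans (⇔-sym (proj₂ rep x y x≢y)) (⇔-trans (alternate⇔narrow x y w x≢y) (narrow⇔excess≤1 x y w))

-- The 3-uniform word

<∸⇒+< : ∀ a b c → a < b ∸ c → a + c < b
<∸⇒+< a b c a<b∸c with c ≤? b
... | yes c≤b = subst (a + c <_) (m∸n+n≡m c≤b) (+-monoˡ-< c a<b∸c)
... | no c≰b = ⊥-elim (<⇒≱ a<b∸c (≤-trans (≤-reflexive (m≤n⇒m∸n≡0 (<⇒≤ (≰⇒> c≰b)))) z≤n))

+<⇒<∸ : ∀ a b c → a + c < b → a < b ∸ c
+<⇒<∸ a b c a+c<b = m+n≤o⇒m≤o∸n (suc a) a+c<b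

lt-⊔ : ∀ {a x y} → a < x ⊔ y → a < x ⊎ a < y
lt-⊔ {a} {x} {y} lt with ⊔-sel x y
... | inj₁ e = inj₁ (subst (a <_) e lt)
... | inj₂ e = inj₂ (subst (a <_) e lt)

-- For a vertex a of the first class and b of the second, with mab = excess a b and mba = excess b a,
-- the heights h₀ < h₁ < h₂ chosen for a interleave the heights β, β + q, β + 2q of b
-- exactly when mab + mba ≤ 1, that is, when a and b are adjacent.
module KeyArithmetic (q S U β β̄ mab mba m₂ : ℕ)
  (floorS : mab * q ≤ S + β × S + β < suc mab * q)
  (floorU : mba * q ≤ U + β̄ × U + β̄ < suc mba * q)
  (split : β + β̄ + 1 ≡ q) (U≤q : U ≤ q) (positive : 1 ≤ mab + mba)
  (q≤m₂ : q ≤ m₂) (m₂≤h₂ : m₂ ≤ (3 * q ∸ S) ⊔ (U + q)) (h₂≤m₂+q : (3 * q ∸ S) ⊔ (U + q) ≤ m₂ + q) where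

  open +-*-Solver

  h₀ h₁ h₂ : ℕ
  h₀ = U
  h₁ = (U + q) ⊓ m₂
  h₂ = (3 * q ∸ S) ⊔ (U + q)

  FirstLeads SecondLeads : Set
  FirstLeads = h₀ ≤ β × β < h₁ × h₁ ≤ β + q × β + q < h₂ × h₂ ≤ β + q + q
  SecondLeads = β < h₀ × h₀ ≤ β + q × β + q < h₁ × h₁ ≤ β + q + q × β + q + q < h₂

  private
    mul-< : ∀ {m k s} → m * q ≤ s → s < k * q → m < k
    mul-< {m} {k} le lt = *-cancelʳ-< q m k (≤-<-trans le lt)

    1*q : 1 * q ≡ q
    1*q = +-identityʳ q

    2*q : 2 * q ≡ q + q
    2*q = cong (q +_) (+-identityʳ q)

    3*q : 3 * q ≡ q + q + q
    3*q = solve 1 (λ q → con 3 :* q := q :+ q :+ q) refl q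

    q≡ : q ≡ suc (β + β̄)
    q≡ = trans (sym split) (+-comm _ 1)

    β<q : β < q
    β<q = subst (β <_) (sym q≡) (s≤s (m≤m+n β β̄))

    β̄<q : β̄ < q
    β̄<q = subst (β̄ <_) (sym q≡) (s≤s (m≤n+m β̄ β))

    mba≡0 : U ≤ β → mba ≡ 0
    mba≡0 U≤β = n<1⇒n≡0 (mul-< (proj₁ floorU) (begin-strict
      U + β̄  ≤⟨ +-monoˡ-≤ β̄ U≤β ⟩
      β + β̄  <⟨ subst (β + β̄ <_) (trans (sym q≡) (sym 1*q)) ≤-refl ⟩
      1 * q  ∎))
      where open ≤-Reasoning

    mba≡1 : β < U → mba ≡ 1
    mba≡1 β<U = ≤-antisym
      (s≤s⁻¹ (mul-< (proj₁ floorU) (begin-strict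
        U + β̄  ≤⟨ +-monoˡ-≤ β̄ U≤q ⟩
        q + β̄  <⟨ +-monoʳ-< q β̄<q ⟩
        q + q  ≡⟨ 2*q ⟨
        2 * q  ∎)))
      (s≤s⁻¹ (mul-< (≤-reflexive 1*q) (begin-strict
        q          ≡⟨ q≡ ⟩
        suc β + β̄  ≤⟨ +-monoˡ-≤ β̄ β<U ⟩
        U + β̄      <⟨ proj₂ floorU ⟩
        suc mba * q ∎)))
      where open ≤-Reasoning

    mab≤1⇒ : mab ≤ 1 → S + β < q + q
    mab≤1⇒ le = subst (S + β <_) 2*q (<-≤-trans (proj₂ floorS) (*-monoˡ-≤ q (s≤s le)))

    ⇒mab≤1 : S + β < q + q → mab ≤ 1
    ⇒mab≤1 lt = s≤s⁻¹ (mul-< (proj₁ floorS) (subst (S + β <_) (sym 2*q) lt))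

    mab≡0⇒ : mab ≡ 0 → S + β < q
    mab≡0⇒ e = subst (S + β <_) (trans (cong (λ m → suc m * q) e) 1*q) (proj₂ floorS)

    ⇒mab≡0 : S + β < q → mab ≡ 0
    ⇒mab≡0 lt = n<1⇒n≡0 (mul-< (proj₁ floorS) (subst (S + β <_) (sym 1*q) lt))

    mab≥1⇒ : 1 ≤ mab → q ≤ S + β
    mab≥1⇒ le = ≤-trans (≤-reflexive (sym 1*q)) (≤-trans (*-monoˡ-≤ q le) (proj₁ floorS))

    below2q⇒ : S + β < q + q → β + q < 3 * q ∸ S
    below2q⇒ lt = +<⇒<∸ (β + q) (3 * q) S (subst₂ _<_
      (solve 3 (λ β q S → S :+ β :+ q := β :+ q :+ S) refl β q S) (sym 3*q) (+-monoˡ-< q lt))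

    ⇒below2q : β + q < 3 * q ∸ S → S + β < q + q
    ⇒below2q lt = +-cancelʳ-< q (S + β) (q + q) (subst₂ _<_
      (solve 3 (λ β q S → β :+ q :+ S := S :+ β :+ q) refl β q S) 3*q (<∸⇒+< (β + q) (3 * q) S lt))

    belowq⇒ : S + β < q → β + q + q < 3 * q ∸ S
    belowq⇒ lt = +<⇒<∸ (β + q + q) (3 * q) S (subst₂ _<_
      (solve 3 (λ β q S → S :+ β :+ (q :+ q) := β :+ q :+ q :+ S) refl β q S)
      (trans (solve 1 (λ q → q :+ (q :+ q) := q :+ q :+ q) refl q) (sym 3*q)) (+-monoˡ-< (q + q) lt))

    ⇒belowq : β + q + q < 3 * q ∸ S → S + β < q
    ⇒belowq lt = +-cancelʳ-< (q + q) (S + β) q (subst₂ _<_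
      (solve 3 (λ β q S → β :+ q :+ q :+ S := S :+ β :+ (q :+ q)) refl β q S)
      (trans 3*q (solve 1 (λ q → q :+ q :+ q := q :+ (q :+ q)) refl q)) (<∸⇒+< (β + q + q) (3 * q) S lt))

    atLeastq⇒ : q ≤ S + β → 3 * q ∸ S ≤ β + q + q
    atLeastq⇒ le = m≤n+o⇒m∸n≤o (3 * q) S (subst₂ _≤_
      (trans (sym (+-assoc q q q)) (sym 3*q)) (solve 3 (λ β q S → S :+ β :+ (q :+ q) := S :+ (β :+ q :+ q)) refl β q S)
      (+-monoˡ-≤ (q + q) le))

    q≤h₁ : q ≤ h₁
    q≤h₁ = ⊓-glb (m≤n+m q U) q≤m₂

    h₁≤U+q : h₁ ≤ U + q
    h₁≤U+q = m⊓n≤m (U + q) m₂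

  interleave⇔adjacent : (FirstLeads ⊎ SecondLeads) ⇔ mab + mba ≤ 1
  interleave⇔adjacent = mk⇔ forward backward
    where
    forward : FirstLeads ⊎ SecondLeads → mab + mba ≤ 1
    forward (inj₁ (U≤β , _ , _ , β+q<h₂ , _)) with lt-⊔ β+q<h₂
    ... | inj₁ lt = subst (λ z → mab + z ≤ 1) (sym (mba≡0 U≤β)) (subst (_≤ 1) (sym (+-identityʳ mab)) (⇒mab≤1 (⇒below2q lt)))
    ... | inj₂ lt = ⊥-elim (<⇒≱ (+-cancelʳ-< q β U lt) U≤β)
    forward (inj₂ (β<U , _ , _ , _ , β+2q<h₂)) with lt-⊔ β+2q<h₂
    ... | inj₁ lt = subst (λ z → z + mba ≤ 1) (sym (⇒mab≡0 (⇒belowq lt))) (≤-reflexive (mba≡1 β<U))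
    ... | inj₂ lt = ⊥-elim (<⇒≱ (+-cancelʳ-< q (β + q) U lt) (≤-trans U≤q (m≤n+m q β)))
    backward : mab + mba ≤ 1 → FirstLeads ⊎ SecondLeads
    backward sum≤1 with U ≤? β
    ... | yes U≤β = inj₁ (U≤β , <-≤-trans β<q q≤h₁ , ≤-trans h₁≤U+q (+-monoˡ-≤ q U≤β) ,
                          <-≤-trans (below2q⇒ (mab≤1⇒ mab≤1)) (m≤m⊔n _ _) ,
                          ⊔-lub (atLeastq⇒ (mab≥1⇒ mab≥1)) (≤-trans (+-monoˡ-≤ q U≤β) (m≤m+n (β + q) q)))
      where
      mab≡sum : mab + mba ≡ mab
      mab≡sum = trans (cong (mab +_) (mba≡0 U≤β)) (+-identityʳ mab)
      mab≤1 : mab ≤ 1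
      mab≤1 = subst (_≤ 1) mab≡sum sum≤1
      mab≥1 : 1 ≤ mab
      mab≥1 = subst (1 ≤_) mab≡sum positive
    ... | no U≰β = inj₂ (β<U , ≤-trans U≤q (m≤n+m q β) ,
                         ⊓-glb (+-monoˡ-< q β<U) (+-cancelʳ-< q (β + q) m₂ (<-≤-trans big h₂≤m₂+q)) ,
                         ≤-trans h₁≤U+q (≤-trans (+-monoˡ-≤ q U≤q) (≤-trans (m≤n+m (q + q) β) (≤-reflexive (sym (+-assoc β q q))))) ,
                         big)
      where
      β<U : β < U
      β<U = ≰⇒> U≰β
      mab≡0 : mab ≡ 0
      mab≡0 = n≤0⇒n≡0 (+-cancelʳ-≤ 1 mab 0 (subst (λ z → mab + z ≤ 1) (mba≡1 β<U) sum≤1))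
      big : β + q + q < h₂
      big = <-≤-trans (belowq⇒ (mab≡0⇒ mab≡0)) (m≤m⊔n _ _)

occ-suc-tabulate : {m : ℕ} (x : Fin n) (f : Fin m → Fin n) → occ (Fin.suc x) (tabulate (Fin.suc ∘ f)) ≡ occ x (tabulate f)
occ-suc-tabulate {m = zero} x f = refl
occ-suc-tabulate {m = suc m} x f with f Fin.zero ≟ x
... | yes _ = cong suc (occ-suc-tabulate x (f ∘ Fin.suc))
... | no _ = occ-suc-tabulate x (f ∘ Fin.suc)

occ-zero-tabulate : {m : ℕ} (f : Fin m → Fin n) → occ Fin.zero (tabulate (Fin.suc ∘ f)) ≡ 0
occ-zero-tabulate {m = zero} f = refl
occ-zero-tabulate {m = suc m} f = occ-zero-tabulate (f ∘ Fin.suc)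

occ-allFin : (x : Fin n) → occ x (allFin n) ≡ 1
occ-allFin {suc n} Fin.zero = cong suc (occ-zero-tabulate {n} (λ i → i))
occ-allFin {suc n} (Fin.suc x) = trans (occ-suc-tabulate x (λ i → i)) (occ-allFin x)

occ-selection : (f : Fin n → ℕ) (k : ℕ) (x : Fin n) → occ x (filter (λ z → f z ℕ.≟ k) (allFin n)) ≡ bit (f x ℕ.≟ k)
occ-selection f k x with f x ℕ.≟ k
... | yes fx≡k = trans (occ-filter-accept (λ z → f z ℕ.≟ k) fx≡k (allFin _)) (occ-allFin x)
... | no fx≢k = occ-filter-reject (λ z → f z ℕ.≟ k) fx≢k (allFin _)

indicator<-suc : (a k : ℕ) → indicator< a (suc k) ≡ indicator< a k + bit (a ℕ.≟ k)
indicator<-suc a k with a <? k | a ℕ.≟ k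
... | yes a<k | yes refl = ⊥-elim (<-irrefl refl a<k)
... | yes a<k | no _ = indicator<-yes (m<n⇒m<1+n a<k)
... | no _ | yes refl = indicator<-yes (n<1+n a)
... | no a≮k | no a≢k = indicator<-no (≤∧≢⇒< (≮⇒≥ a≮k) (a≢k ∘ sym))

occTake-zeroOrAll : (x : Fin n) (B : Word n) → occ x B ≤ 1 → ∀ s → occTake x s B ≡ 0 ⊎ occTake x s B ≡ occ x B
occTake-zeroOrAll x B x≤1 s with occTake x s B ≤? 0
... | yes none = inj₁ (n≤0⇒n≡0 none)
... | no some = inj₂ (≤-antisym (occTake≤occ x s B) (≤-trans x≤1 (≰⇒> some)))

blockPrefix : {x y : Fin n} (B : Word n) → occ x B ≤ 1 → occ y B ≤ 1 → occ x B ≡ 0 ⊎ occ y B ≡ 0 → ∀ s →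
  (occTake x s B ≡ 0 × occTake y s B ≡ 0) ⊎ (occTake x s B ≡ occ x B × occTake y s B ≡ occ y B)
blockPrefix {x = x} {y} B x≤1 y≤1 (inj₁ x≡0) s with occTake-zeroOrAll y B y≤1 s
... | inj₁ y0 = inj₁ (occTake-absent x B x≡0 s , y0)
... | inj₂ yAll = inj₂ (trans (occTake-absent x B x≡0 s) (sym x≡0) , yAll)
blockPrefix {x = x} {y} B x≤1 y≤1 (inj₂ y≡0) s with occTake-zeroOrAll x B x≤1 s
... | inj₁ x0 = inj₁ (x0 , occTake-absent y B y≡0 s)
... | inj₂ xAll = inj₂ (xAll , trans (occTake-absent y B y≡0 s) (sym y≡0))

module KeyedWord (n : ℕ) (k₀ k₁ k₂ : Fin n → ℕ) (K : ℕ)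
  (k₀<k₁ : ∀ x → k₀ x < k₁ x) (k₁<k₂ : ∀ x → k₁ x < k₂ x) (k₂<K : ∀ x → k₂ x < K) where

  block : ℕ → Word n
  block k = withKey k₀ ++ withKey k₁ ++ withKey k₂
    where
    withKey : (Fin n → ℕ) → Word n
    withKey kᵢ = filter (λ z → kᵢ z ℕ.≟ k) (allFin n)

  prefixWord : ℕ → Word n
  prefixWord zero = []
  prefixWord (suc k) = prefixWord k ++ block k

  keyedWord : Word n
  keyedWord = prefixWord K

  count : Fin n → ℕ → ℕ
  count x k = indicator< (k₀ x) k + (indicator< (k₁ x) k + indicator< (k₂ x) k)

  occ-block : ∀ x k → occ x (block k) ≡ bit (k₀ x ℕ.≟ k) + (bit (k₁ x ℕ.≟ k) + bit (k₂ x ℕ.≟ k))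
  occ-block x k = trans (occ-++ x (selection k₀) _) (cong₂ _+_ (occ-selection k₀ k x)
    (trans (occ-++ x (selection k₁) (selection k₂)) (cong₂ _+_ (occ-selection k₁ k x) (occ-selection k₂ k x))))
    where
    selection : (Fin n → ℕ) → Word n
    selection f = filter (λ z → f z ℕ.≟ k) (allFin n)

  occ-prefixWord : ∀ x k → occ x (prefixWord k) ≡ count x k
  occ-prefixWord x zero = refl
  occ-prefixWord x (suc k) = begin
    occ x (prefixWord k ++ block k)     ≡⟨ occ-++ x (prefixWord k) (block k) ⟩
    occ x (prefixWord k) + occ x (block k) ≡⟨ cong₂ _+_ (occ-prefixWord x k) (occ-block x k) ⟩
    count x k + (bit (k₀ x ℕ.≟ k) + (bit (k₁ x ℕ.≟ k) + bit (k₂ x ℕ.≟ k)))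
      ≡⟨ solve 6 (λ a b c d e f → (a :+ (b :+ c)) :+ (d :+ (e :+ f)) := (a :+ d) :+ ((b :+ e) :+ (c :+ f))) refl
           (indicator< (k₀ x) k) (indicator< (k₁ x) k) (indicator< (k₂ x) k) _ _ _ ⟩
    (indicator< (k₀ x) k + bit (k₀ x ℕ.≟ k)) + ((indicator< (k₁ x) k + bit (k₁ x ℕ.≟ k)) + (indicator< (k₂ x) k + bit (k₂ x ℕ.≟ k)))
      ≡⟨ sym (cong₂ _+_ (indicator<-suc (k₀ x) k) (cong₂ _+_ (indicator<-suc (k₁ x) k) (indicator<-suc (k₂ x) k))) ⟩
    count x (suc k) ∎
    where
    open ≡-Reasoning
    open +-*-Solver

  uniform : Uniform 3 keyedWord
  uniform x = trans (occ-prefixWord x K) (cong₂ _+_ all₀ (cong₂ _+_ all₁ all₂))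
    where
    all₀ : indicator< (k₀ x) K ≡ 1
    all₀ = indicator<-yes (<-trans (k₀<k₁ x) (<-trans (k₁<k₂ x) (k₂<K x)))
    all₁ : indicator< (k₁ x) K ≡ 1
    all₁ = indicator<-yes (<-trans (k₁<k₂ x) (k₂<K x))
    all₂ : indicator< (k₂ x) K ≡ 1
    all₂ = indicator<-yes (k₂<K x)

  member : ∀ x → x ∈ keyedWord
  member x = occ>0⇒∈ keyedWord (subst (0 <_) (sym (uniform x)) z<s)

  IsKey : Fin n → ℕ → Set
  IsKey x k = k₀ x ≡ k ⊎ k₁ x ≡ k ⊎ k₂ x ≡ k

  isKey? : ∀ x k → Dec (IsKey x k)
  isKey? x k = (k₀ x ℕ.≟ k) ⊎-dec ((k₁ x ℕ.≟ k) ⊎-dec (k₂ x ℕ.≟ k))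

  occ-block-nonKey : ∀ {x k} → ¬ IsKey x k → occ x (block k) ≡ 0
  occ-block-nonKey {x} {k} ¬key = trans (occ-block x k) (cong₂ _+_ (bit-no (k₀ x ℕ.≟ k) (¬key ∘ inj₁))
    (cong₂ _+_ (bit-no (k₁ x ℕ.≟ k) (¬key ∘ inj₂ ∘ inj₁)) (bit-no (k₂ x ℕ.≟ k) (¬key ∘ inj₂ ∘ inj₂))))

  occ-block≤1 : ∀ x k → occ x (block k) ≤ 1
  occ-block≤1 x k = subst (_≤ 1) (sym (occ-block x k)) bits≤1
    where
    bits≤1 : bit (k₀ x ℕ.≟ k) + (bit (k₁ x ℕ.≟ k) + bit (k₂ x ℕ.≟ k)) ≤ 1
    bits≤1 with k₀ x ℕ.≟ k | k₁ x ℕ.≟ k | k₂ x ℕ.≟ k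
    ... | no _ | no _ | d = bit≤1 d
    ... | yes _ | no _ | no _ = ≤-refl
    ... | no _ | yes _ | no _ = ≤-refl
    ... | yes refl | yes e | _ = ⊥-elim (<-irrefl (sym e) (k₀<k₁ x))
    ... | yes refl | no _ | yes e = ⊥-elim (<-irrefl (sym e) (<-trans (k₀<k₁ x) (k₁<k₂ x)))
    ... | no _ | yes refl | yes e = ⊥-elim (<-irrefl (sym e) (k₁<k₂ x))

  count-saturated : ∀ x {k} → K ≤ k → count x k ≡ 3
  count-saturated x {k} K≤k = cong₂ _+_ (indicator<-yes (<-≤-trans (<-trans (k₀<k₁ x) (<-trans (k₁<k₂ x) (k₂<K x))) K≤k))
    (cong₂ _+_ (indicator<-yes (<-≤-trans (<-trans (k₁<k₂ x) (k₂<K x)) K≤k)) (indicator<-yes (<-≤-trans (k₂<K x) K≤k)))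

  count>0⇒ : ∀ x k → 0 < count x k → k₀ x < k
  count>0⇒ x k pos with k ≤? k₀ x
  ... | no k≰k₀ = ≰⇒> k≰k₀
  ... | yes k≤k₀ = ⊥-elim (<-irrefl (sym none) pos)
    where
    none : count x k ≡ 0
    none = cong₂ _+_ (indicator<-no k≤k₀)
      (cong₂ _+_ (indicator<-no (≤-trans k≤k₀ (<⇒≤ (k₀<k₁ x)))) (indicator<-no (≤-trans k≤k₀ (<⇒≤ (<-trans (k₀<k₁ x) (k₁<k₂ x))))))

  count>1⇒ : ∀ x k → 1 < count x k → k₁ x < k
  count>1⇒ x k big with k ≤? k₁ x
  ... | no k≰k₁ = ≰⇒> k≰k₁
  ... | yes k≤k₁ = ⊥-elim (<⇒≱ big (begin
    count x k                            ≡⟨ cong (λ i → indicator< (k₀ x) k + (indicator< (k₁ x) k + i)) (indicator<-no (≤-trans k≤k₁ (<⇒≤ (k₁<k₂ x)))) ⟩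
    indicator< (k₀ x) k + (indicator< (k₁ x) k + 0) ≡⟨ cong (λ i → indicator< (k₀ x) k + (i + 0)) (indicator<-no k≤k₁) ⟩
    indicator< (k₀ x) k + 0              ≤⟨ +-monoˡ-≤ 0 (indicator<≤1 (k₀ x) k) ⟩
    1                                    ∎))
    where open ≤-Reasoning

  count>2⇒ : ∀ x k → 2 < count x k → k₂ x < k
  count>2⇒ x k big with k ≤? k₂ x
  ... | no k≰k₂ = ≰⇒> k≰k₂
  ... | yes k≤k₂ = ⊥-elim (<⇒≱ big (begin
    count x k                            ≡⟨ cong (λ i → indicator< (k₀ x) k + (indicator< (k₁ x) k + i)) (indicator<-no k≤k₂) ⟩
    indicator< (k₀ x) k + (indicator< (k₁ x) k + 0) ≤⟨ +-mono-≤ (indicator<≤1 (k₀ x) k) (+-monoˡ-≤ 0 (indicator<≤1 (k₁ x) k)) ⟩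
    2                                    ∎))
    where open ≤-Reasoning

  >0-count : ∀ x {k} → k₀ x < k → 0 < count x k
  >0-count x lt = subst (λ i → 0 < i + _) (sym (indicator<-yes lt)) z<s

  >1-count : ∀ x {k} → k₁ x < k → 1 < count x k
  >1-count x lt = subst₂ (λ i j → 1 < i + (j + _)) (sym (indicator<-yes (<-trans (k₀<k₁ x) lt))) (sym (indicator<-yes lt)) (s≤s (s≤s z≤n))

  >2-count : ∀ x {k} → k₂ x < k → 2 < count x k
  >2-count x lt = subst₂ (λ i j → 2 < i + (j + indicator< (k₂ x) _)) (sym (indicator<-yes (<-trans (k₀<k₁ x) (<-trans (k₁<k₂ x) lt))))
    (sym (indicator<-yes (<-trans (k₁<k₂ x) lt))) (subst (λ i → 2 < 2 + i) (sym (indicator<-yes lt)) ≤-refl)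

  Interleaved : Fin n → Fin n → Set
  Interleaved x y = k₀ x < k₀ y × k₀ y < k₁ x × k₁ x < k₁ y × k₁ y < k₂ x × k₂ x < k₂ y

  interleaved⇒countLead : ∀ {x y} → Interleaved x y → ∀ k → LeadsBy≤1 (count x k) (count y k)
  interleaved⇒countLead {x} {y} (a , b , c , d , e) k =
    +-mono-≤ (indicator<-anti k (<⇒≤ a)) (+-mono-≤ (indicator<-anti k (<⇒≤ c)) (indicator<-anti k (<⇒≤ e))) ,
    ≤-trans (+-mono-≤ (indicator<≤1 (k₀ x) k) (+-mono-≤ (indicator<-anti k (<⇒≤ b)) (indicator<-anti k (<⇒≤ d))))
            (s≤s (+-monoʳ-≤ (indicator< (k₀ y) k) (m≤m+n (indicator< (k₁ y) k) (indicator< (k₂ y) k))))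

  NoSharedKey : Fin n → Fin n → Set
  NoSharedKey x y = ∀ k → IsKey x k → IsKey y k → ⊥

  countLead⇒interleaved : ∀ {x y} → NoSharedKey x y → (∀ k → LeadsBy≤1 (count x k) (count y k)) → Interleaved x y
  countLead⇒interleaved {x} {y} apart L =
    strict (count>0⇒ x (suc (k₀ y)) (ahead (suc (k₀ y)) (>0-count y (n<1+n (k₀ y))))) (λ e → apart _ (inj₁ e) (inj₁ refl)) ,
    strict (count>0⇒ y (suc (k₁ x)) (behind (suc (k₁ x)) (>1-count x (n<1+n (k₁ x))))) (λ e → apart _ (inj₂ (inj₁ refl)) (inj₁ e)) ,
    strict (count>1⇒ x (suc (k₁ y)) (ahead (suc (k₁ y)) (>1-count y (n<1+n (k₁ y))))) (λ e → apart _ (inj₂ (inj₁ e)) (inj₂ (inj₁ refl))) ,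
    strict (count>1⇒ y (suc (k₂ x)) (behind (suc (k₂ x)) (>2-count x (n<1+n (k₂ x))))) (λ e → apart _ (inj₂ (inj₂ refl)) (inj₂ (inj₁ e))) ,
    strict (count>2⇒ x (suc (k₂ y)) (ahead (suc (k₂ y)) (>2-count y (n<1+n (k₂ y))))) (λ e → apart _ (inj₂ (inj₂ e)) (inj₂ (inj₂ refl)))
    where
    ahead : ∀ k {j} → j < count y k → j < count x k
    ahead k lt = <-≤-trans lt (proj₁ (L k))
    behind : ∀ k {j} → suc j < count x k → j < count y k
    behind k lt = s≤s⁻¹ (<-≤-trans lt (proj₂ (L k)))
    strict : ∀ {a b} → a < suc b → a ≢ b → a < b
    strict lt ne = ≤∧≢⇒< (s≤s⁻¹ lt) ne

  noSharedBlock : ∀ {x y} → NoSharedKey x y → ∀ k → occ x (block k) ≡ 0 ⊎ occ y (block k) ≡ 0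
  noSharedBlock {x} apart k with isKey? x k
  ... | no ¬key = inj₁ (occ-block-nonKey ¬key)
  ... | yes key = inj₂ (occ-block-nonKey (apart k key))

  prefixAtBoundary : ∀ {x y} → NoSharedKey x y → ∀ K′ t →
    ∃ λ k → occTake x t (prefixWord K′) ≡ count x k × occTake y t (prefixWord K′) ≡ count y k
  prefixAtBoundary {x} {y} apart zero t = 0 , cong (occ x) (take-[] t) , cong (occ y) (take-[] t)
  prefixAtBoundary {x} {y} apart (suc K′) = splitAt (length (prefixWord K′)) _ inPrefix inBlock
    where
    inPrefix : ∀ t → t ≤ length (prefixWord K′) →
      ∃ λ k → occTake x t (prefixWord (suc K′)) ≡ count x k × occTake y t (prefixWord (suc K′)) ≡ count y k
    inPrefix t t≤ = let (k , ex , ey) = prefixAtBoundary apart K′ t in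
      k , trans (occTake-++ˡ x _ (block K′) t≤) ex , trans (occTake-++ˡ y _ (block K′) t≤) ey
    atEnd : ∀ z s → occTake z (length (prefixWord K′) + s) (prefixWord (suc K′)) ≡ count z K′ + occTake z s (block K′)
    atEnd z s = trans (occTake-++ʳ z (prefixWord K′) (block K′) s) (cong (_+ occTake z s (block K′)) (occ-prefixWord z K′))
    inBlock : ∀ s → ∃ λ k → occTake x (length (prefixWord K′) + s) (prefixWord (suc K′)) ≡ count x k
                          × occTake y (length (prefixWord K′) + s) (prefixWord (suc K′)) ≡ count y k
    inBlock s with blockPrefix (block K′) (occ-block≤1 x K′) (occ-block≤1 y K′) (noSharedBlock apart K′) s
    ... | inj₁ (x0 , y0) = K′ , trans (atEnd x s) (trans (cong (count x K′ +_) x0) (+-identityʳ _)) ,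
                                trans (atEnd y s) (trans (cong (count y K′ +_) y0) (+-identityʳ _))
    ... | inj₂ (xAll , yAll) = suc K′ , full x xAll , full y yAll
      where
      full : ∀ z → occTake z s (block K′) ≡ occ z (block K′) →
        occTake z (length (prefixWord K′) + s) (prefixWord (suc K′)) ≡ count z (suc K′)
      full z all = trans (atEnd z s) (trans (cong (count z K′ +_) all)
        (trans (cong (_+ occ z (block K′)) (sym (occ-prefixWord z K′))) (trans (sym (occ-++ z (prefixWord K′) (block K′))) (occ-prefixWord z (suc K′)))))

  prefixWord-prefix : ∀ {k K′} → k ≤ K′ → ∃ λ rest → prefixWord K′ ≡ prefixWord k ++ rest
  prefixWord-prefix {K′ = zero} z≤n = [] , refl
  prefixWord-prefix {k} {suc K′} k≤ with m≤n⇒m<n∨m≡n k≤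
  ... | inj₂ refl = [] , sym (++-identityʳ _)
  ... | inj₁ k<sK′ = let (rest , e) = prefixWord-prefix (s≤s⁻¹ k<sK′) in
    rest ++ block K′ , trans (cong (_++ block K′) e) (++-assoc (prefixWord k) rest (block K′))

  occTake-boundary : ∀ z {k} → k ≤ K → occTake z (length (prefixWord k)) keyedWord ≡ count z k
  occTake-boundary z {k} k≤K = let (rest , e) = prefixWord-prefix k≤K in begin
    occTake z (length (prefixWord k)) keyedWord            ≡⟨ cong (occTake z (length (prefixWord k))) e ⟩
    occTake z (length (prefixWord k)) (prefixWord k ++ rest) ≡⟨ occTake-++ˡ z (prefixWord k) rest ≤-refl ⟩
    occTake z (length (prefixWord k)) (prefixWord k)        ≡⟨ occTake-all z (prefixWord k) ≤-refl ⟩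
    occ z (prefixWord k)                                    ≡⟨ occ-prefixWord z k ⟩
    count z k                                               ∎
    where open ≡-Reasoning

  lead⇔interleaved : ∀ {x y} → NoSharedKey x y → Lead x y keyedWord ⇔ Interleaved x y
  lead⇔interleaved {x} {y} apart = mk⇔ (countLead⇒interleaved apart ∘ countLead) (lead ∘ interleaved⇒countLead)
    where
    countLead : Lead x y keyedWord → ∀ k → LeadsBy≤1 (count x k) (count y k)
    countLead L k with k ≤? K
    ... | yes k≤K = subst₂ LeadsBy≤1 (occTake-boundary x k≤K) (occTake-boundary y k≤K) (L (length (prefixWord k)))
    ... | no k≰K = subst₂ LeadsBy≤1 (sym (count-saturated x (<⇒≤ (≰⇒> k≰K))))
                     (sym (count-saturated y (<⇒≤ (≰⇒> k≰K)))) (≤-refl , n≤1+n 3)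
    lead : (∀ k → LeadsBy≤1 (count x k) (count y k)) → Lead x y keyedWord
    lead C t = let (k , ex , ey) = prefixAtBoundary apart K t in subst₂ LeadsBy≤1 (sym ex) (sym ey) (C k)

  alternate⇔interleaved : ∀ {x y} → x ≢ y → NoSharedKey x y → Alternate x y keyedWord ⇔ (Interleaved x y ⊎ Interleaved y x)
  alternate⇔interleaved {x} {y} x≢y apart = ⇔-trans (alternate⇔lead x y keyedWord x≢y)
    (lead⇔interleaved apart ⊎-⇔ lead⇔interleaved (λ k ky kx → apart k kx ky))

lex-< : ∀ M {Q Q′ R R′} → R < M → Q < Q′ → Q * M + R < Q′ * M + R′
lex-< M {Q} {Q′} {R} {R′} R<M Q<Q′ = begin-strict
  Q * M + R      <⟨ +-monoʳ-< (Q * M) R<M ⟩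
  Q * M + M      ≡⟨ +-comm (Q * M) M ⟩
  suc Q * M      ≤⟨ *-monoˡ-≤ M Q<Q′ ⟩
  Q′ * M         ≤⟨ m≤m+n (Q′ * M) R′ ⟩
  Q′ * M + R′    ∎
  where open ≤-Reasoning

lex-≤-< : ∀ M {Q Q′ R R′} → Q ≤ Q′ → R < R′ → Q * M + R < Q′ * M + R′
lex-≤-< M Q≤Q′ R<R′ = +-mono-≤-< (*-monoˡ-≤ M Q≤Q′) R<R′

lex-<⇒ : ∀ M {Q Q′ R R′} → R′ < M → Q * M + R < Q′ * M + R′ → Q ≤ Q′
lex-<⇒ M {Q} {Q′} R′<M lt with Q ≤? Q′
... | yes Q≤Q′ = Q≤Q′
... | no Q≰Q′ = ⊥-elim (<-asym lt (lex-< M R′<M (≰⇒> Q≰Q′)))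

lex-injective : ∀ M {Q Q′ R R′} → R < M → R′ < M → Q * M + R ≡ Q′ * M + R′ → Q ≡ Q′ × R ≡ R′
lex-injective M {Q} {Q′} R<M R′<M e with <-cmp Q Q′
... | tri< Q<Q′ _ _ = ⊥-elim (<-irrefl e (lex-< M R<M Q<Q′))
... | tri> _ _ Q>Q′ = ⊥-elim (<-irrefl (sym e) (lex-< M R′<M Q>Q′))
... | tri≈ _ refl _ = refl , +-cancelˡ-≡ (Q * M) _ _ e

odd<2*suc : ∀ t → 2 * t + 1 < 2 * suc t
odd<2*suc t = ≤-reflexive (solve 1 (λ t → con 1 :+ (con 2 :* t :+ con 1) := con 2 :* (con 1 :+ t)) refl t)
  where open +-*-Solver

even<odd⇔ : ∀ h t → 2 * h < 2 * t + 1 ⇔ h ≤ t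
even<odd⇔ h t = mk⇔
  (λ lt → ≮⇒≥ (λ t<h → <-asym lt (<-≤-trans (odd<2*suc t) (*-monoʳ-≤ 2 t<h))))
  (λ le → ≤-<-trans (*-monoʳ-≤ 2 le) (m<m+n (2 * t) z<s))

odd<even⇔ : ∀ h t → 2 * t + 1 < 2 * h ⇔ t < h
odd<even⇔ h t = mk⇔
  (λ lt → ≰⇒> (λ h≤t → <-asym lt (from (even<odd⇔ h t) h≤t)))
  (λ t<h → <-≤-trans (odd<2*suc t) (*-monoʳ-≤ 2 t<h))

even≢odd′ : ∀ h t → 2 * h ≢ 2 * t + 1
even≢odd′ h t e = even≢odd h t (trans e (+-comm (2 * t) 1))

minAll : (Fin n → ℕ) → ℕ → ℕ
minAll {zero} f d = d
minAll {suc n} f d = f Fin.zero ⊓ minAll (f ∘ Fin.suc) d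

minAll-≤ : (f : Fin n → ℕ) (d : ℕ) (i : Fin n) → minAll f d ≤ f i
minAll-≤ f d Fin.zero = m⊓n≤m _ _
minAll-≤ f d (Fin.suc i) = ≤-trans (m⊓n≤n _ _) (minAll-≤ (f ∘ Fin.suc) d i)

minAll-glb : (f : Fin n → ℕ) (d : ℕ) {m : ℕ} → (∀ i → m ≤ f i) → m ≤ d → m ≤ minAll f d
minAll-glb {zero} f d _ m≤d = m≤d
minAll-glb {suc n} f d below m≤d = ⊓-glb (below Fin.zero) (minAll-glb (f ∘ Fin.suc) d (below ∘ Fin.suc) m≤d)

minAll-attained : (f : Fin n → ℕ) (d : ℕ) → minAll f d ≡ d ⊎ ∃ λ i → minAll f d ≡ f i
minAll-attained {zero} f d = inj₁ refl
minAll-attained {suc n} f d with ⊓-sel (f Fin.zero) (minAll (f ∘ Fin.suc) d)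
... | inj₁ e = inj₂ (Fin.zero , e)
... | inj₂ e with minAll-attained (f ∘ Fin.suc) d
...   | inj₁ e′ = inj₁ (trans e e′)
...   | inj₂ (i , e′) = inj₂ (Fin.suc i , trans e e′)

-- The i-th copy of a vertex a of the first class sits at the even height 2·hᵢ(a), the i-th copy of a
-- vertex b of the second class at the odd height 2·(β b + i·q) + 1; ties within the first class are
-- broken by the copy index and the rank α.
module ThreeUniform {n : ℕ} (G : Graph n) (c : Fin n → Bool) (cb : ComplementColouring G c)
  (w : Word n) (rep : Represents w G) (a* : Fin n) (ca* : c a* ≡ true)
  (dominated : ∀ b → c b ≡ false → ∀ t → occTake b t w ≤ occTake a* t w) where

  open ClassSum c
  open ClassOrder G c cb w rep
  open +-*-Solver

  q : ℕ
  q = classSize false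

  α β β̄ S U : Fin n → ℕ
  α = rank true
  β = rank false
  β̄ = corank false
  S = outExcess false
  U = inExcess false

  U≤q : ∀ a → c a ≡ true → U a ≤ q
  U≤q a ca = subst (λ u → U a ≤ u + q) U-a*≡0 (inExcess-spread (trans ca (sym ca*)))
    where
    U-a*≡0 : U a* ≡ 0
    U-a*≡0 = trans (classSum-cong (λ b cb≡f → excess≡0 (dominated b cb≡f))) (classSum-const 0)

  h₂ : Fin n → ℕ
  h₂ a = (3 * q ∸ S a) ⊔ (U a + q)

  m₂ : ℕ
  m₂ = minAll (λ x → if c x then h₂ x else 3 * q) (3 * q)

  h₁ : Fin n → ℕ
  h₁ a = (U a + q) ⊓ m₂

  q≤3q : q ≤ 3 * q
  q≤3q = m≤m+n q (q + (q + 0))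

  2q≤3q : q + q ≤ 3 * q
  2q≤3q = subst (q + q ≤_) (solve 1 (λ q → q :+ q :+ q := con 3 :* q) refl q) (m≤m+n (q + q) q)

  h₂≤3q : ∀ a → c a ≡ true → h₂ a ≤ 3 * q
  h₂≤3q a ca = ⊔-lub (m∸n≤m (3 * q) (S a)) (≤-trans (+-monoˡ-≤ q (U≤q a ca)) 2q≤3q)

  h₂-spread : ∀ a a′ → c a ≡ true → c a′ ≡ true → h₂ a ≤ h₂ a′ + q
  h₂-spread a a′ ca ca′ = ⊔-lub
    (≤-trans (m≤n+o⇒m∸n≤o (3 * q) (S a) (begin
        3 * q                          ≤⟨ m≤n+m∸n (3 * q) (S a′) ⟩
        S a′ + (3 * q ∸ S a′)          ≤⟨ +-monoˡ-≤ _ (outExcess-spread (trans ca (sym ca′))) ⟩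
        S a + q + (3 * q ∸ S a′)       ≡⟨ solve 3 (λ s q d → s :+ q :+ d := s :+ (d :+ q)) refl (S a) q (3 * q ∸ S a′) ⟩
        S a + ((3 * q ∸ S a′) + q)     ∎))
      (+-monoˡ-≤ q (m≤m⊔n _ _)))
    (≤-trans (+-monoˡ-≤ q (inExcess-spread (trans ca (sym ca′)))) (+-monoˡ-≤ q (m≤n⊔m _ _)))
    where open ≤-Reasoning

  q≤m₂ : q ≤ m₂
  q≤m₂ = minAll-glb _ (3 * q) entry q≤3q
    where
    entry : ∀ x → q ≤ (if c x then h₂ x else 3 * q)
    entry x with c x
    ... | true = ≤-trans (m≤n+m q (U x)) (m≤n⊔m _ _)
    ... | false = q≤3q

  m₂≤h₂ : ∀ a → c a ≡ true → m₂ ≤ h₂ a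
  m₂≤h₂ a ca = subst (λ γ → m₂ ≤ (if γ then h₂ a else 3 * q)) ca (minAll-≤ _ (3 * q) a)

  h₂≤m₂+q : ∀ a → c a ≡ true → h₂ a ≤ m₂ + q
  h₂≤m₂+q a ca with minAll-attained (λ x → if c x then h₂ x else 3 * q) (3 * q)
  ... | inj₁ e = ≤-trans (h₂≤3q a ca) (subst (3 * q ≤_) (cong (_+ q) (sym e)) (m≤m+n _ _))
  ... | inj₂ (i , e) = byColour (c i) refl
    where
    byColour : ∀ γ → c i ≡ γ → h₂ a ≤ m₂ + q
    m₂≡ : ∀ {γ} → c i ≡ γ → m₂ ≡ (if γ then h₂ i else 3 * q)
    m₂≡ ci = trans e (cong (λ γ → if γ then h₂ i else 3 * q) ci)
    byColour true ci = ≤-trans (h₂-spread a i ca ci) (≤-reflexive (cong (_+ q) (sym (m₂≡ ci))))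
    byColour false ci = ≤-trans (h₂≤3q a ca) (≤-trans (m≤m+n _ q) (≤-reflexive (cong (_+ q) (sym (m₂≡ ci)))))

  height : ℕ → Fin n → ℕ
  height zero = U
  height (suc zero) = h₁
  height (suc (suc _)) = h₂

  height-step : ∀ i {a a′} → i ≤ 1 → c a ≡ true → c a′ ≡ true → height i a′ ≤ height (suc i) a
  height-step zero _ _ ca′ = ≤-trans (U≤q _ ca′) (⊓-glb (m≤n+m q _) q≤m₂)
  height-step (suc zero) _ ca _ = ≤-trans (m⊓n≤n _ _) (m₂≤h₂ _ ca)
  height-step (suc (suc _)) (s≤s ()) _ _

  height-mono : ∀ i {a a′} → Precedes a a′ → c a ≡ c a′ → height i a ≤ height i a′
  height-mono zero aa′ ca≡ = inExcess-mono aa′ ca≡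
  height-mono (suc zero) aa′ ca≡ = ⊓-monoˡ-≤ m₂ (+-monoˡ-≤ q (inExcess-mono aa′ ca≡))
  height-mono (suc (suc _)) aa′ ca≡ = ⊔-mono-≤ (∸-monoʳ-≤ (3 * q) (outExcess-anti aa′ ca≡)) (+-monoˡ-≤ q (inExcess-mono aa′ ca≡))

  secondHeight : ℕ → Fin n → ℕ
  secondHeight zero b = β b
  secondHeight (suc zero) b = β b + q
  secondHeight (suc (suc _)) b = β b + q + q

  secondHeight≡ : ∀ i b → i ≤ 2 → secondHeight i b ≡ i * q + β b
  secondHeight≡ zero b _ = refl
  secondHeight≡ (suc zero) b _ = solve 2 (λ β q → β :+ q := q :+ con 0 :+ β) refl (β b) q
  secondHeight≡ (suc (suc zero)) b _ = solve 2 (λ β q → β :+ q :+ q := q :+ (q :+ con 0) :+ β) refl (β b) q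
  secondHeight≡ (suc (suc (suc _))) b (s≤s (s≤s ()))

  n>0 : 0 < n
  n>0 = ≤-<-trans z≤n (toℕ<n a*)

  M₀ : ℕ
  M₀ = 3 * n

  M₀>0 : 0 < M₀
  M₀>0 = *-monoʳ-< 3 n>0

  firstKey secondKey : ℕ → Fin n → ℕ
  firstKey i a = 2 * height i a * M₀ + (i * n + α a)
  secondKey i b = (2 * secondHeight i b + 1) * M₀ + 0

  key : ℕ → Fin n → ℕ
  key i x = if c x then firstKey i x else secondKey i x

  key-first : ∀ i {a} → c a ≡ true → key i a ≡ firstKey i a
  key-first i ca = cong (λ γ → if γ then firstKey i _ else secondKey i _) ca

  key-second : ∀ i {b} → c b ≡ false → key i b ≡ secondKey i b
  key-second i cb≡f = cong (λ γ → if γ then firstKey i _ else secondKey i _) cb≡f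

  α<n : ∀ a → c a ≡ true → α a < n
  α<n a ca = <-≤-trans (rank<classSize ca) classSize≤n

  q>0 : ∀ b → c b ≡ false → 0 < q
  q>0 b cb≡f = ≤-<-trans z≤n (rank<classSize cb≡f)

  tieBreak<M₀ : ∀ i a → i ≤ 2 → c a ≡ true → i * n + α a < M₀
  tieBreak<M₀ i a i≤2 ca = <-≤-trans (+-monoʳ-< (i * n) (α<n a ca))
    (≤-trans (≤-reflexive (+-comm (i * n) n)) (*-monoˡ-≤ n (s≤s i≤2)))

  key-step : ∀ i x → i ≤ 1 → key i x < key (suc i) x
  key-step i x i≤1 = byColour (c x) refl
    where
    byColour : ∀ γ → c x ≡ γ → key i x < key (suc i) x
    byColour true cx = subst₂ _<_ (sym (key-first i cx)) (sym (key-first (suc i) cx))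
      (lex-≤-< M₀ (*-monoʳ-≤ 2 (height-step i i≤1 cx cx)) (+-monoˡ-< (α x) (m<n+m (i * n) n>0)))
    byColour false cx = subst₂ _<_ (sym (key-second i cx)) (sym (key-second (suc i) cx))
      (lex-< M₀ M₀>0 (+-monoˡ-< 1 (*-monoʳ-< 2 (step i i≤1))))
      where
      step : ∀ i → i ≤ 1 → secondHeight i x < secondHeight (suc i) x
      step zero _ = m<m+n (β x) (q>0 x cx)
      step (suc zero) _ = m<m+n (β x + q) (q>0 x cx)
      step (suc (suc _)) (s≤s ())

  K : ℕ
  K = (2 * (3 * n) + 1) * M₀ + 0

  3q≤3n : 3 * q ≤ 3 * n
  3q≤3n = *-monoʳ-≤ 3 classSize≤n

  lastKey<K : ∀ x → key 2 x < K
  lastKey<K x = byColour (c x) refl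
    where
    byColour : ∀ γ → c x ≡ γ → key 2 x < K
    byColour true cx = subst (_< K) (sym (key-first 2 cx)) (lex-< M₀ (tieBreak<M₀ 2 x (s≤s (s≤s z≤n)) cx)
      (from (even<odd⇔ (height 2 x) (3 * n)) (≤-trans (h₂≤3q x cx) 3q≤3n)))
    byColour false cx = subst (_< K) (sym (key-second 2 cx)) (lex-< M₀ M₀>0 (+-monoˡ-< 1 (*-monoʳ-< 2 (begin-strict
      β x + q + q    <⟨ +-monoˡ-< q (+-monoˡ-< q (rank<classSize cx)) ⟩
      q + q + q      ≡⟨ solve 1 (λ q → q :+ q :+ q := con 3 :* q) refl q ⟩
      3 * q          ≤⟨ 3q≤3n ⟩
      3 * n          ∎))))
      where open ≤-Reasoning

  key-injective : ∀ {x y} i j → i ≤ 2 → j ≤ 2 → key i x ≡ key j y → x ≡ y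
  key-injective {x} {y} i j i≤2 j≤2 e = byColours (c x) (c y) refl refl
    where
    byColours : ∀ γ δ → c x ≡ γ → c y ≡ δ → x ≡ y
    byColours true true cx cy =
      let e′ = proj₂ (lex-injective M₀ {2 * height i x} {2 * height j y} (tieBreak<M₀ i x i≤2 cx) (tieBreak<M₀ j y j≤2 cy)
                       (trans (sym (key-first i cx)) (trans e (key-first j cy)))) in
      rank-injective cx cy (proj₂ (lex-injective n {i} {j} (α<n x cx) (α<n y cy) e′))
    byColours false false cx cy =
      let e′ = proj₁ (lex-injective M₀ {2 * secondHeight i x + 1} {2 * secondHeight j y + 1} {0} {0} M₀>0 M₀>0
                       (trans (sym (key-second i cx)) (trans e (key-second j cy))))
          e″ = *-cancelˡ-≡ (secondHeight i x) (secondHeight j y) 2 (+-cancelʳ-≡ 1 (2 * secondHeight i x) (2 * secondHeight j y) e′) in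
      rank-injective cx cy (proj₂ (lex-injective q {i} {j} (rank<classSize cx) (rank<classSize cy)
        (trans (sym (secondHeight≡ i x i≤2)) (trans e″ (secondHeight≡ j y j≤2)))))
    byColours true false cx cy = ⊥-elim (even≢odd′ (height i x) (secondHeight j y) (proj₁ (lex-injective M₀ {R′ = 0} (tieBreak<M₀ i x i≤2 cx) M₀>0
      (trans (sym (key-first i cx)) (trans e (key-second j cy))))))
    byColours false true cx cy = ⊥-elim (even≢odd′ (height j y) (secondHeight i x) (sym (proj₁ (lex-injective M₀ {R = 0} M₀>0 (tieBreak<M₀ j y j≤2 cy)
      (trans (sym (key-second i cx)) (trans e (key-first j cy)))))))

  open KeyedWord n (key 0) (key 1) (key 2) K (λ x → key-step 0 x z≤n) (λ x → key-step 1 x (s≤s z≤n)) lastKey<K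

  noSharedKey : ∀ {x y} → x ≢ y → NoSharedKey x y
  noSharedKey {x} {y} x≢y k kx ky = x≢y (key-injective (copy kx) (copy ky) (copy≤2 kx) (copy≤2 ky) (trans (at kx) (sym (at ky))))
    where
    copy : ∀ {z} → IsKey z k → ℕ
    copy (inj₁ _) = 0
    copy (inj₂ (inj₁ _)) = 1
    copy (inj₂ (inj₂ _)) = 2
    copy≤2 : ∀ {z} (kz : IsKey z k) → copy kz ≤ 2
    copy≤2 (inj₁ _) = z≤n
    copy≤2 (inj₂ (inj₁ _)) = s≤s z≤n
    copy≤2 (inj₂ (inj₂ _)) = s≤s (s≤s z≤n)
    at : ∀ {z} (kz : IsKey z k) → key (copy kz) z ≡ k
    at (inj₁ e) = e
    at (inj₂ (inj₁ e)) = e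
    at (inj₂ (inj₂ e)) = e

  firstClass-interleaved : ∀ {a a′} → Precedes a a′ → c a ≡ true → c a′ ≡ true → Interleaved a a′
  firstClass-interleaved {a} {a′} aa′ ca ca′ = same 0 , cross 0 z≤n , same 1 , cross 1 (s≤s z≤n) , same 2
    where
    keys : ∀ i j → firstKey i a < firstKey j a′ → key i a < key j a′
    keys i j = subst₂ _<_ (sym (key-first i ca)) (sym (key-first j ca′))
    keys′ : ∀ i j → firstKey i a′ < firstKey j a → key i a′ < key j a
    keys′ i j = subst₂ _<_ (sym (key-first i ca′)) (sym (key-first j ca))
    same : ∀ i → key i a < key i a′
    same i = keys i i (lex-≤-< M₀ (*-monoʳ-≤ 2 (height-mono i aa′ (trans ca (sym ca′)))) (+-monoʳ-< (i * n) (rank-< aa′ ca)))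
    cross : ∀ i → i ≤ 1 → key i a′ < key (suc i) a
    cross i i≤1 = keys′ i (suc i) (lex-≤-< M₀ (*-monoʳ-≤ 2 (height-step i i≤1 ca ca′))
      (<-≤-trans (+-monoʳ-< (i * n) (α<n a′ ca′)) (≤-trans (≤-reflexive (+-comm (i * n) n)) (m≤m+n (n + i * n) (α a)))))

  secondClass-interleaved : ∀ {b b′} → Precedes b b′ → c b ≡ false → c b′ ≡ false → Interleaved b b′
  secondClass-interleaved {b} {b′} bb′ cb≡f cb′≡f =
    same 0 z≤n , cross 0 z≤n , same 1 (s≤s z≤n) , cross 1 (s≤s z≤n) , same 2 (s≤s (s≤s z≤n))
    where
    keys : ∀ {u v} i j → c u ≡ false → c v ≡ false → secondHeight i u < secondHeight j v → key i u < key j v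
    keys i j cu cv lt = subst₂ _<_ (sym (key-second i cu)) (sym (key-second j cv)) (lex-< M₀ M₀>0 (+-monoˡ-< 1 (*-monoʳ-< 2 lt)))
    β<β′ : β b < β b′
    β<β′ = rank-< bb′ cb≡f
    same : ∀ i → i ≤ 2 → key i b < key i b′
    same zero _ = keys 0 0 cb≡f cb′≡f β<β′
    same (suc zero) _ = keys 1 1 cb≡f cb′≡f (+-monoˡ-< q β<β′)
    same (suc (suc zero)) _ = keys 2 2 cb≡f cb′≡f (+-monoˡ-< q (+-monoˡ-< q β<β′))
    same (suc (suc (suc _))) (s≤s (s≤s ()))
    cross : ∀ i → i ≤ 1 → key i b′ < key (suc i) b
    cross zero _ = keys 0 1 cb′≡f cb≡f (<-≤-trans (rank<classSize cb′≡f) (m≤n+m q (β b)))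
    cross (suc zero) _ = keys 1 2 cb′≡f cb≡f (+-monoˡ-< q (<-≤-trans (rank<classSize cb′≡f) (m≤n+m q (β b))))
    cross (suc (suc _)) (s≤s ())

  module Mixed {a b : Fin n} (ca : c a ≡ true) (cb≡f : c b ≡ false) where

    a≢b : a ≢ b
    a≢b refl = true≢false (trans (sym ca) cb≡f)
      where
      true≢false : true ≢ false
      true≢false ()

    first<second⇔ : ∀ i j → i ≤ 2 → key i a < key j b ⇔ height i a ≤ secondHeight j b
    first<second⇔ i j i≤2 = mk⇔
      (λ lt → to (even<odd⇔ _ _) (≤∧≢⇒< (lex-<⇒ M₀ {R′ = 0} M₀>0 (subst₂ _<_ (key-first i ca) (key-second j cb≡f) lt))
                                        (even≢odd′ (height i a) (secondHeight j b))))
      (λ le → subst₂ _<_ (sym (key-first i ca)) (sym (key-second j cb≡f))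
        (lex-< M₀ (tieBreak<M₀ i a i≤2 ca) (from (even<odd⇔ _ _) le)))

    second<first⇔ : ∀ i j → i ≤ 2 → key j b < key i a ⇔ secondHeight j b < height i a
    second<first⇔ i j i≤2 = mk⇔
      (λ lt → to (odd<even⇔ _ _) (≤∧≢⇒< (lex-<⇒ M₀ (tieBreak<M₀ i a i≤2 ca) (subst₂ _<_ (key-second j cb≡f) (key-first i ca) lt))
                                         (even≢odd′ (height i a) (secondHeight j b) ∘ sym)))
      (λ lt → subst₂ _<_ (sym (key-second j cb≡f)) (sym (key-first i ca))
        (lex-< M₀ {R = 0} M₀>0 (from (odd<even⇔ _ _) lt)))

    open KeyArithmetic q (S a) (U a) (β b) (β̄ b) (excess a b w) (excess b a w) m₂
      (excess-floorʳ cb≡f a) (excess-floorˡ cb≡f a) (rank+corank cb≡f) (U≤q a ca)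
      (excess-sum>0 a b w a≢b (proj₁ rep a)) q≤m₂ (m₂≤h₂ a ca) (h₂≤m₂+q a ca)

    interleaved⇔adjacent : (Interleaved a b ⊎ Interleaved b a) ⇔ Adjacent G a b
    interleaved⇔adjacent = ⇔-trans (firstLeads ⊎-⇔ secondLeads)
      (⇔-trans interleave⇔adjacent (⇔-sym (adjacent⇔excess≤1 a b a≢b)))
      where
      i≤2 : ∀ {i} → i ≤ 1 → i ≤ 2
      i≤2 = m≤n⇒m≤1+n
      firstLeads : Interleaved a b ⇔ FirstLeads
      firstLeads = first<second⇔ 0 0 z≤n ×-⇔ (second<first⇔ 1 0 (s≤s z≤n) ×-⇔ (first<second⇔ 1 1 (s≤s z≤n) ×-⇔
                   (second<first⇔ 2 1 (s≤s (s≤s z≤n)) ×-⇔ first<second⇔ 2 2 (s≤s (s≤s z≤n)))))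
      secondLeads : Interleaved b a ⇔ SecondLeads
      secondLeads = second<first⇔ 0 0 z≤n ×-⇔ (first<second⇔ 0 1 z≤n ×-⇔ (second<first⇔ 1 1 (s≤s z≤n) ×-⇔
                    (first<second⇔ 1 2 (s≤s z≤n) ×-⇔ second<first⇔ 2 2 (s≤s (s≤s z≤n)))))

  interleaved⇔adjacent : ∀ x y → x ≢ y → (Interleaved x y ⊎ Interleaved y x) ⇔ Adjacent G x y
  interleaved⇔adjacent x y x≢y = byColours (c x) (c y) refl refl
    where
    sameClass : c x ≡ c y → (∀ {u v} → Precedes u v → c u ≡ c x → c v ≡ c x → Interleaved u v) →
      (Interleaved x y ⊎ Interleaved y x) ⇔ Adjacent G x y
    sameClass cx≡cy interleavedOf = mk⇔ (λ _ → sameColour⇒adjacent {G = G} cb x≢y cx≡cy)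
      (λ _ → [ (λ xy → inj₁ (interleavedOf xy refl (sym cx≡cy))) , (λ yx → inj₂ (interleavedOf yx (sym cx≡cy) refl)) ]′
               (precedes-total x≢y cx≡cy))
    byColours : ∀ γ δ → c x ≡ γ → c y ≡ δ → (Interleaved x y ⊎ Interleaved y x) ⇔ Adjacent G x y
    byColours true true cx cy = sameClass (trans cx (sym cy)) λ uv cu cv → firstClass-interleaved uv (trans cu cx) (trans cv cx)
    byColours false false cx cy = sameClass (trans cx (sym cy)) λ uv cu cv → secondClass-interleaved uv (trans cu cx) (trans cv cx)
    byColours true false cx cy = Mixed.interleaved⇔adjacent cx cy
    byColours false true cx cy = ⇔-trans ⊎-swap⇔ (⇔-trans (Mixed.interleaved⇔adjacent cy cx)
      (mk⇔ (trans (symm G x y)) (trans (symm G y x))))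

  threeRepresentable : KRepresentable 3 G
  threeRepresentable = keyedWord , uniform , member , λ x y x≢y →
    ⇔-trans (alternate⇔interleaved x≢y (noSharedKey x≢y)) (interleaved⇔adjacent x y x≢y)

coBipartite⇒threeRepresentable : (G : Graph n) (c : Fin n → Bool) → ComplementColouring G c →
  WordRepresentable G → (a : Fin n) → c a ≡ true → KRepresentable 3 G
coBipartite⇒threeRepresentable G c cb wr a ca =
  let (k , w , U , rep) = wordRepresentable⇒uniform G wr
      module D = Dominate G c cb k w U rep a
  in ThreeUniform.threeRepresentable G c cb D.w′ D.rep′ a ca D.dominates

monochromatic⇒permutationGraph : (G : Graph n) (c : Fin n → Bool) → ComplementColouring G c →
  (∀ x → c x ≡ false) → PermutationGraph G
monochromatic⇒permutationGraph G c cb allFalse = complete⇒permutationGraph G λ x y x≢y →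
  sameColour⇒adjacent {G = G} cb x≢y (trans (allFalse x) (sym (allFalse y)))

mainTheorem3 : ∀ {n : ℕ} (G : Graph n) →
    WordRepresentable G → CoBipartite G → ¬ PermutationGraph G →
    RepresentationNumber≡ G 3
mainTheorem3 G wr (c , cb) ¬perm = threeRep , notBelow3
  where
  threeRep : KRepresentable 3 G
  threeRep with any? (λ a → c a Bool.≟ true)
  ... | yes (a , ca) = coBipartite⇒threeRepresentable G c cb wr a ca
  ... | no none = ⊥-elim (¬perm (monochromatic⇒permutationGraph G c cb λ x → Bool.¬-not (λ cx → none (x , cx))))
  notBelow3 : ∀ k → 1 ≤ k → k < 3 → ¬ KRepresentable k G
  notBelow3 1 _ _ = ¬perm ∘ oneRepresentable⇒permutationGraph G
  notBelow3 2 _ _ = ¬perm ∘ twoRepresentable⇒permutationGraph G (c , cb)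
  notBelow3 (suc (suc (suc _))) _ (s≤s (s≤s (s≤s ())))
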